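{- Let $k,s\geq 1$ and $r\geq 2$ be integers. Then there exists $n_0(k,s,r)$ such that for all $n>n_0(k,s,r)$ the following holds: if $\mathcal{H}$ is an $r$-uniform hypergraph on the vertex set $[n]=\{1,\dots,n\}$ with matching number $\nu(\mathcal{H})<s$, then $$N\big(S_{r-1,k}^r,\mathcal{H}\big)\leq N\Big(S_{r-1,k}^r,\binom{[n]}{r}-\binom{[s,n]}{r}\Big).$$ Moreover, equality holds if and only if $\mathcal{H}$ is the $r$-uniform hypergraph consisting of all $r$-subsets of $[n]$ that intersect a fixed $(s-1)$-subset of $[n]$.
   Context: An $r$-uniform hypergraph ($r$-graph) is identified with its set of hyperedges, each hyperedge being an $r$-subset of the vertex set. For a set $V$, $\binom{V}{r}$ is the family of all $r$-subsets of $V$; $[m,n]=\{m,m+1,\dots,n\}$. Thus $\binom{[n]}{r}-\binom{[s,n]}{r}$ is the $r$-graph of all $r$-subsets of $[n]$ intersecting $[s-1]$. The matching number $\nu(\mathcal{H})$ is the maximum number of pairwise disjoint hyperedges of $\mathcal{H}$. For integers $r>t\geq 0$ and $k\geq1$, $S_{t,k}^r$ (a sunflower) is the $r$-graph with hyperedges $e_1,\dots,e_k$ such that there is a $t$-set $T$ with $e_i\cap e_j=T$ for all $1\le i<j\le k$ (for $k=1$ it is a single hyperedge). For $r$-graphs $\mathcal{F},\mathcal{G}$, $N(\mathcal{F},\mathcal{G})$ denotes the number of copies of $\mathcal{F}$ in $\mathcal{G}$, i.e. the number of subhypergraphs (subsets of hyperedges) of $\mathcal{G}$ isomorphic to $\mathcal{F}$.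 -}

module Defs where

open import Data.Bool using (Bool; true; false; _∧_; _∨_; if_then_else_)
open import Data.Bool.Properties using () renaming (_≟_ to _≟B_)
open import Data.Nat using (ℕ; zero; suc; _<ᵇ_; _≡ᵇ_; _∸_)
open import Data.Fin using (Fin; toℕ)
open import Data.Fin.Subset using (Subset; inside; outside; _∩_; ∣_∣; Empty; Nonempty)
open import Data.List using (List; []; _∷_; _++_; map; filter; length)
open import Data.Vec using (Vec; []; _∷_; tabulate)
open import Data.Vec.Properties using (≡-dec)
open import Data.Product using (Σ; _×_)
open import Relation.Nullary using (¬_; does)
open import Relation.Binary.PropositionalEquality using (_≡_)

Hypergraph : ℕ → Set
Hypergraph n = Subset n → Bool

Uniform : ∀ {n} → ℕ → Hypergraph n → Set
Uniform {n} r H = ∀ (e : Subset n) → H e ≡ true → ∣ e ∣ ≡ r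

HasMatching : ∀ {n} → Hypergraph n → ℕ → Set
HasMatching {n} H m =
  Σ (Fin m → Subset n) λ f →
    (∀ i → H (f i) ≡ true) × (∀ i j → ¬ (i ≡ j) → Empty (f i ∩ f j))

MatchingNumberLt : ∀ {n} → Hypergraph n → ℕ → Set
MatchingNumberLt H s = ∀ m → s Data.Nat.≤ m → ¬ HasMatching H m

allSubsets : ∀ n → List (Subset n)
allSubsets zero = [] ∷ []
allSubsets (suc n) = map (inside ∷_) (allSubsets n) ++ map (outside ∷_) (allSubsets n)

edges : ∀ {n} → Hypergraph n → List (Subset n)
edges {n} H = filter (λ e → H e ≟B true) (allSubsets n)

combinations : ∀ {A : Set} → ℕ → List A → List (List A)
combinations zero _ = [] ∷ []
combinations (suc k) [] = []
combinations (suc k) (x ∷ xs) =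
  map (x ∷_) (combinations k xs) ++ combinations (suc k) xs

_==S_ : ∀ {n} → Subset n → Subset n → Bool
a ==S b = does (≡-dec _≟B_ a b)

allB : ∀ {A : Set} → (A → Bool) → List A → Bool
allB p [] = true
allB p (x ∷ xs) = p x ∧ allB p xs

pairwiseMeet : ∀ {n} → Subset n → List (Subset n) → Bool
pairwiseMeet T [] = true
pairwiseMeet T (e ∷ es) = allB (λ f → (e ∩ f) ==S T) es ∧ pairwiseMeet T es

-- Is the family of (r-uniform) edges es a sunflower S^r_{t,k} (k = length es)?
-- k = 1 : a single hyperedge; k ≥ 2 : there is a t-set T with e_i ∩ e_j = T
-- for all i < j (necessarily T = e_1 ∩ e_2).
isSunflower : ∀ {n} → ℕ → List (Subset n) → Bool
isSunflower t [] = true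
isSunflower t (e ∷ []) = true
isSunflower t (e ∷ f ∷ es) = (∣ e ∩ f ∣ ≡ᵇ t) ∧ pairwiseMeet (e ∩ f) (e ∷ f ∷ es)

numSunflowers : ∀ {n} → ℕ → ℕ → Hypergraph n → ℕ
numSunflowers k r H = length (filter (λ c → isSunflower (r ∸ 1) c ≟B true) (combinations k (edges H)))

-- the (s-1)-set [s-1] = {1,…,s-1} ⊆ [n], i.e. the first s-1 elements of Fin n
initialSeg : ∀ n → ℕ → Subset n
initialSeg n s = tabulate (λ i → toℕ i <ᵇ (s ∸ 1))

meets : ∀ {n} → Subset n → Subset n → Bool
meets {zero} [] [] = false
meets {suc n} (a ∷ p) (b ∷ q) = (a ∧ b) ∨ meets p q

-- binom([n], r) − binom([s,n], r): all r-subsets of [n] meeting [s-1]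
extremal : ∀ n r s → Hypergraph n
extremal n r s e = (∣ e ∣ ≡ᵇ r) ∧ meets e (initialSeg n s)

-- For k ≥ 2 a copy of S^r_{r-1,k} is a k-set of edges through a common (r−1)-set T, and T
-- is unique because distinct r-sets share at most r − 1 points; hence
-- N(S, H) = ∑_{|T| = r−1} C(deg_H T, k), and for k = 1 this sum is r · |H|.
--
-- Call a vertex heavy if its degree exceeds c · C(n−2, r−2), c = r + (r+1)s. Codegrees are at
-- most C(n−2, r−2), so a heavy vertex lies on an edge avoiding any c other vertices, and heavy
-- vertices can be matched greedily: ν(H) < s forces the heavy set A to have |A| ≤ s − 1.
-- If |A| = s − 1, every edge meets A (else it extends such a matching), so H is contained in
-- the r-graph of r-sets hitting A, which is isomorphic to the extremal one; the sum above is
-- monotone and strictly so as soon as an edge through an (r−1)-set meeting A is missing.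
-- If |A| < s − 1, a maximal matching among the edges avoiding A covers at most r(s−1) light
-- vertices, so only O(n^{r−2}) edges avoid A. Splitting the (r−1)-sets T by whether they meet A
-- bounds the sum by the value for the r-sets hitting A plus O(n^{k−1} n^{r−2}), whereas
-- enlarging the hitting set to s − 1 points gains Ω(n^k n^{r−2}); so for large n, H loses.

{-# OPTIONS --safe #-}
module Submission where

open import Data.Bool using (Bool; true; false; _∧_; _∨_; not; if_then_else_)
open import Data.Bool.Properties
  using (∨-zeroʳ; ∨-conicalˡ; ∨-conicalʳ; ∧-comm; ∧-conicalˡ; ∧-conicalʳ; not-injective) renaming (_≟_ to _≟ᵇ_)
open import Data.Empty using (⊥-elim)
open import Data.Fin using (Fin; zero; suc; toℕ)
open import Data.Fin.Subset
  using (Subset; inside; outside; _⊆_; _∈_; _∉_; _∩_; _∪_; ∁; ⊥; ⊤; ⁅_⁆; ⋃; ∣_∣; Nonempty; Empty)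
open import Data.Fin.Subset.Properties
  using ( _⊆?_; _∈?_; drop-∷-⊆; p⊆q⇒∣p∣≤∣q∣; ⊥⊆; ⊆⊤; ∣⊥∣≡0; ∣⊤∣≡n; ∣∁p∣≡n∸∣p∣; ∣⁅x⁆∣≡1
        ; p∩q⊆p; p∩q⊆q; ∣p∩q∣≤∣p∣; x∈p∩q⁺; ∪-identityˡ; ∪-identityʳ; x∈p∪q⁻; x∈p∪q⁺
        ; x∈⁅x⁆; x∈⁅y⁆⇒x≡y; ∉⊥; x∈∁p⇒x∉p)
open import Data.List using (List; []; _∷_; _++_; map; length; filter; allFin; foldr)
import Data.List as List
open import Data.List.Properties using (map-tabulate; length-map; length-take)
open import Data.List.Membership.Propositional using () renaming (_∈_ to _∈ˡ_)
open import Data.List.Membership.Propositional.Properties using (∈-++⁺ˡ; ∈-++⁺ʳ; ∈-map⁺; ∈-lookup)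
open import Data.List.Relation.Unary.Any using (here; there)
open import Data.List.Relation.Unary.All as All using (All; []; _∷_)
import Data.List.Relation.Unary.All.Properties as All
open import Data.List.Relation.Unary.AllPairs using (AllPairs; []; _∷_)
import Data.List.Relation.Unary.AllPairs as AllPairs
import Data.List.Relation.Unary.AllPairs.Properties as AllPairs
open import Data.List.Relation.Unary.Unique.Propositional using (Unique)
import Data.List.Relation.Unary.Unique.Propositional.Properties as Unique
open import Data.Nat
open import Data.Nat.Properties
open import Data.Nat.Combinatorics using (_C_; nCk+nC[k+1]≡[n+1]C[k+1]; k>n⇒nCk≡0; nCn≡1; nC1≡n; nCk≡nC[n∸k])
open import Data.Nat.Tactic.RingSolver using (solve-∀)
open import Data.Product using (_,_; _×_; proj₁; proj₂; ∃-syntax)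
open import Data.Sum using (inj₁; inj₂; [_,_]′)
open import Data.Vec using ([]; _∷_; here; there; tabulate)
open import Data.Vec.Properties using (≡-dec; ∷-injectiveʳ; lookup∘tabulate; []=⇒lookup; lookup⇒[]=)
open import Function using (_∘_)
open import Function.Bundles using (_⇔_; mk⇔; Equivalence)
open import Relation.Binary.Definitions using (tri<; tri≈; tri>)
open import Relation.Binary.PropositionalEquality
open import Relation.Nullary using (Dec; does; yes; no; ¬_; contradiction)
open import Relation.Nullary.Decidable using (dec-true)
open import Relation.Unary using (Decidable)
open import Defs

⟦_⟧ : Bool → ℕ
⟦ true ⟧  = 1
⟦ false ⟧ = 0

-- Indicators are taken of decisions, so `𝟙 (m ≟ n)` is definitionally `⟦ m ≡ᵇ n ⟧`, and
-- `𝟙 (T ⊆? e)`, `𝟙 (v ∈? e)` compute on the heads of the vectors; the inductions over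
-- subsets below rely on this.
𝟙 : ∀ {p} {P : Set p} → Dec P → ℕ
𝟙 d = ⟦ does d ⟧

𝟙-yes : ∀ {p} {P : Set p} (d : Dec P) → P → 𝟙 d ≡ 1
𝟙-yes (yes _) _  = refl
𝟙-yes (no ¬p) p = contradiction p ¬p

𝟙-no : ∀ {p} {P : Set p} (d : Dec P) → ¬ P → 𝟙 d ≡ 0
𝟙-no (yes p) ¬p = contradiction p ¬p
𝟙-no (no _)  _  = refl

does⇒ : ∀ {p} {P : Set p} (d : Dec P) → does d ≡ true → P
does⇒ (yes p) _ = p

¬does⇒ : ∀ {p} {P : Set p} (d : Dec P) → does d ≡ false → ¬ P
¬does⇒ (no ¬p) _ = ¬p

≡ᵇ-refl : ∀ m → (m ≡ᵇ m) ≡ true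
≡ᵇ-refl zero    = refl
≡ᵇ-refl (suc m) = ≡ᵇ-refl m

≡ᵇ-true⇒≡ : ∀ {m n} → (m ≡ᵇ n) ≡ true → m ≡ n
≡ᵇ-true⇒≡ {m} {n} = does⇒ (m ≟ n)

⟦⟧≤1 : ∀ b → ⟦ b ⟧ ≤ 1
⟦⟧≤1 true  = ≤-refl
⟦⟧≤1 false = z≤n

⟦not⟧+⟦⟧ : ∀ b → ⟦ not b ⟧ + ⟦ b ⟧ ≡ 1
⟦not⟧+⟦⟧ true  = refl
⟦not⟧+⟦⟧ false = refl

∑ : {A : Set} → List A → (A → ℕ) → ℕ
∑ []       f = 0
∑ (x ∷ xs) f = f x + ∑ xs f

infix 5 ∑
syntax ∑ xs (λ x → e) = ∑[ x ∈ xs ] e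

module _ {A : Set} where

  ∑-++ : ∀ xs ys (f : A → ℕ) → ∑ (xs ++ ys) f ≡ ∑ xs f + ∑ ys f
  ∑-++ []       ys f = refl
  ∑-++ (x ∷ xs) ys f = trans (cong (f x +_) (∑-++ xs ys f)) (sym (+-assoc (f x) _ _))

  ∑-map : ∀ {B : Set} (g : B → A) xs (f : A → ℕ) → ∑ (map g xs) f ≡ ∑ xs (λ x → f (g x))
  ∑-map g []       f = refl
  ∑-map g (x ∷ xs) f = cong (f (g x) +_) (∑-map g xs f)

  ∑-cong-All : ∀ {xs} {f g : A → ℕ} → All (λ x → f x ≡ g x) xs → ∑ xs f ≡ ∑ xs g
  ∑-cong-All []           = refl
  ∑-cong-All (fx≡gx ∷ eq) = cong₂ _+_ fx≡gx (∑-cong-All eq)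

  ∑-cong : ∀ xs {f g : A → ℕ} → (∀ x → f x ≡ g x) → ∑ xs f ≡ ∑ xs g
  ∑-cong []       eq = refl
  ∑-cong (x ∷ xs) eq = cong₂ _+_ (eq x) (∑-cong xs eq)

  ∑-mono-≤ : ∀ xs {f g : A → ℕ} → (∀ x → f x ≤ g x) → ∑ xs f ≤ ∑ xs g
  ∑-mono-≤ []       le = z≤n
  ∑-mono-≤ (x ∷ xs) le = +-mono-≤ (le x) (∑-mono-≤ xs le)

  ∑-mono-< : ∀ {xs} {f g : A → ℕ} → (∀ x → f x ≤ g x) → ∀ {y} → y ∈ˡ xs → f y < g y → ∑ xs f < ∑ xs g
  ∑-mono-< {x ∷ xs} le (here refl) lt = +-mono-<-≤ lt (∑-mono-≤ xs le)
  ∑-mono-< {x ∷ xs} le (there y∈) lt = +-mono-≤-< (le x) (∑-mono-< le y∈ lt)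

  ∑-+ : ∀ xs (f g : A → ℕ) → ∑ xs (λ x → f x + g x) ≡ ∑ xs f + ∑ xs g
  ∑-+ []       f g = refl
  ∑-+ (x ∷ xs) f g = trans (cong (f x + g x +_) (∑-+ xs f g)) (+-+-comm (f x) (g x) _ _)
    where
    +-+-comm : ∀ a b c d → a + b + (c + d) ≡ a + c + (b + d)
    +-+-comm = solve-∀

  ∑-*ˡ : ∀ xs c (f : A → ℕ) → ∑ xs (λ x → c * f x) ≡ c * ∑ xs f
  ∑-*ˡ []       c f = sym (*-zeroʳ c)
  ∑-*ˡ (x ∷ xs) c f = trans (cong (c * f x +_) (∑-*ˡ xs c f)) (sym (*-distribˡ-+ c (f x) _))

  ∑-*ʳ : ∀ xs c (f : A → ℕ) → ∑ xs (λ x → f x * c) ≡ ∑ xs f * c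
  ∑-*ʳ xs c f = trans (∑-cong xs (λ x → *-comm (f x) c)) (trans (∑-*ˡ xs c f) (*-comm c (∑ xs f)))

  ∑-zero : ∀ xs {f : A → ℕ} → (∀ x → f x ≡ 0) → ∑ xs f ≡ 0
  ∑-zero []       eq = refl
  ∑-zero (x ∷ xs) eq = cong₂ _+_ (eq x) (∑-zero xs eq)


  ∑-positive : ∀ xs (f : A → ℕ) → 0 < ∑ xs f → ∃[ x ] 0 < f x
  ∑-positive (x ∷ xs) f pos with f x in fx≡
  ... | suc _ = x , subst (0 <_) (sym fx≡) z<s
  ... | zero  = ∑-positive xs f pos

  ∑-filter : ∀ {P : A → Set} (P? : Decidable P) xs (f : A → ℕ) →
    ∑ (filter P? xs) f ≡ (∑[ x ∈ xs ] 𝟙 (P? x) * f x)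
  ∑-filter P? []       f = refl
  ∑-filter P? (x ∷ xs) f with does (P? x)
  ... | true  = cong₂ _+_ (sym (+-identityʳ (f x))) (∑-filter P? xs f)
  ... | false = ∑-filter P? xs f

  length-filter : ∀ {P : A → Set} (P? : Decidable P) xs → length (filter P? xs) ≡ (∑[ x ∈ xs ] 𝟙 (P? x))
  length-filter P? []       = refl
  length-filter P? (x ∷ xs) with does (P? x)
  ... | true  = cong suc (length-filter P? xs)
  ... | false = length-filter P? xs

∑-swap : ∀ {A B : Set} (xs : List A) (ys : List B) (f : A → B → ℕ) →
  ∑[ x ∈ xs ] ∑[ y ∈ ys ] f x y ≡ ∑[ y ∈ ys ] ∑[ x ∈ xs ] f x y
∑-swap []       ys f = sym (∑-zero ys (λ _ → refl))
∑-swap (x ∷ xs) ys f =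
  trans (cong (∑ ys (f x) +_) (∑-swap xs ys f)) (sym (∑-+ ys (f x) (λ y → ∑[ x′ ∈ xs ] f x′ y)))

𝟙[≟true] : ∀ b → 𝟙 (b ≟ᵇ true) ≡ ⟦ b ⟧
𝟙[≟true] true  = refl
𝟙[≟true] false = refl

∑-allSubsets-suc : ∀ {n} (f : Subset (suc n) → ℕ) →
  ∑ (allSubsets (suc n)) f ≡ (∑[ T ∈ allSubsets n ] f (inside ∷ T)) + (∑[ T ∈ allSubsets n ] f (outside ∷ T))
∑-allSubsets-suc {n} f = trans (∑-++ (map (inside ∷_) (allSubsets n)) _ f)
  (cong₂ _+_ (∑-map (inside ∷_) (allSubsets n) f) (∑-map (outside ∷_) (allSubsets n) f))

C-pascal : ∀ n k → suc n C suc k ≡ n C k + n C suc k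
C-pascal n k = sym (nCk+nC[k+1]≡[n+1]C[k+1] n k)

C>0 : ∀ {n k} → k ≤ n → 0 < n C k
C>0 {n}     {zero}  _         = z<s
C>0 {suc n} {suc k} (s≤s k≤n) = begin-strict
  0                       <⟨ C>0 k≤n ⟩
  n C k                   ≤⟨ m≤m+n (n C k) _ ⟩
  n C k + n C suc k       ≡⟨ C-pascal n k ⟨
  suc n C suc k           ∎
  where open ≤-Reasoning

nCk≤[1+n]Ck : ∀ n k → n C k ≤ suc n C k
nCk≤[1+n]Ck n zero    = ≤-refl
nCk≤[1+n]Ck n (suc k) = ≤-trans (m≤n+m (n C suc k) (n C k)) (≤-reflexive (sym (C-pascal n k)))

C-monoˡ-≤ : ∀ {m m′} k → m ≤ m′ → m C k ≤ m′ C k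
C-monoˡ-≤ {m} k m≤m′ with m≤n⇒∃[o]m+o≡n m≤m′
... | o , refl = go o
  where
  go : ∀ o → m C k ≤ (m + o) C k
  go zero    = ≤-reflexive (cong (_C k) (sym (+-identityʳ m)))
  go (suc o) = ≤-trans (go o) (≤-trans (nCk≤[1+n]Ck (m + o) k) (≤-reflexive (cong (_C k) (sym (+-suc m o)))))

C-monoˡ-< : ∀ {d d′ k} → d < d′ → k ≤ d′ → 1 ≤ k → d C k < d′ C k
C-monoˡ-< {d} {suc d′} {suc k} (s≤s d≤d′) (s≤s k≤d′) _ = begin-strict
  d C suc k                  ≡⟨ +-identityˡ (d C suc k) ⟨
  0 + d C suc k              <⟨ +-mono-<-≤ (C>0 k≤d′) (C-monoˡ-≤ (suc k) d≤d′) ⟩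
  d′ C k + d′ C suc k        ≡⟨ C-pascal d′ k ⟨
  suc d′ C suc k             ∎
  where open ≤-Reasoning

[1+n]Cn≡1+n : ∀ n → suc n C n ≡ suc n
[1+n]Cn≡1+n n = begin
  suc n C n                  ≡⟨ nCk≡nC[n∸k] (n≤1+n n) ⟩
  suc n C (suc n ∸ n)        ≡⟨ cong (suc n C_) (m+n∸n≡m 1 n) ⟩
  suc n C 1                  ≡⟨ nC1≡n (suc n) ⟩
  suc n                      ∎
  where open ≡-Reasoning

C≤1 : ∀ {m k} → m ≤ k → m C k ≤ 1
C≤1 {m} {k} m≤k with m≤n⇒m<n∨m≡n m≤k
... | inj₁ m<k  = ≤-trans (≤-reflexive (k>n⇒nCk≡0 m<k)) z≤n
... | inj₂ refl = ≤-reflexive (nCn≡1 m)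

C-+-≤ : ∀ a b k → (a + b) C suc k ≤ a C suc k + b * ((a + b) C k)
C-+-≤ a zero    k = ≤-trans (≤-reflexive (cong (_C suc k) (+-identityʳ a))) (m≤m+n _ _)
C-+-≤ a (suc b) k = begin
  (a + suc b) C suc k                                    ≡⟨ cong (_C suc k) (+-suc a b) ⟩
  suc (a + b) C suc k                                    ≡⟨ C-pascal (a + b) k ⟩
  (a + b) C k + (a + b) C suc k                          ≤⟨ +-mono-≤ (nCk≤[1+n]Ck (a + b) k) (C-+-≤ a b k) ⟩
  suc (a + b) C k + (a C suc k + b * ((a + b) C k))      ≤⟨ +-monoʳ-≤ (suc (a + b) C k)
                                                              (+-monoʳ-≤ (a C suc k) (*-monoʳ-≤ b (nCk≤[1+n]Ck (a + b) k))) ⟩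
  suc (a + b) C k + (a C suc k + b * (suc (a + b) C k))  ≡⟨ rearrange (suc (a + b) C k) (a C suc k) b ⟩
  a C suc k + suc b * (suc (a + b) C k)                  ≡⟨ cong (λ m → a C suc k + suc b * (m C k)) (+-suc a b) ⟨
  a C suc k + suc b * ((a + suc b) C k)                  ∎
  where
  open ≤-Reasoning
  rearrange : ∀ x y b → x + (y + b * x) ≡ y + suc b * x
  rearrange = solve-∀

C-absorption : ∀ m j → suc j * (suc m C suc j) ≡ suc m * (m C j)
C-absorption zero    zero    = refl
C-absorption zero    (suc j) = begin
  suc (suc j) * (1 C suc (suc j))  ≡⟨ cong (suc (suc j) *_) (k>n⇒nCk≡0 {1} {suc (suc j)} (s<s z<s)) ⟩
  suc (suc j) * 0                  ≡⟨ *-zeroʳ (suc (suc j)) ⟩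
  0                                ≡⟨ cong (1 *_) (k>n⇒nCk≡0 {0} {suc j} z<s) ⟨
  1 * (0 C suc j)                  ∎
  where open ≡-Reasoning
C-absorption (suc m) zero    = trans (*-identityˡ _) (trans (nC1≡n (suc (suc m))) (sym (*-identityʳ _)))
C-absorption (suc m) (suc j) = begin
  suc (suc j) * (suc (suc m) C suc (suc j))
    ≡⟨ cong (suc (suc j) *_) (C-pascal (suc m) (suc j)) ⟩
  suc (suc j) * (suc m C suc j + suc m C suc (suc j))
    ≡⟨ *-distribˡ-+ (suc (suc j)) (suc m C suc j) _ ⟩
  suc (suc j) * (suc m C suc j) + suc (suc j) * (suc m C suc (suc j))
    ≡⟨ cong (suc (suc j) * (suc m C suc j) +_) (C-absorption m (suc j)) ⟩
  suc (suc j) * (suc m C suc j) + suc m * (m C suc j)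
    ≡⟨ rearrange (suc j) (suc m C suc j) (suc m * (m C suc j)) ⟩
  suc m C suc j + (suc j * (suc m C suc j) + suc m * (m C suc j))
    ≡⟨ cong (λ x → suc m C suc j + (x + suc m * (m C suc j))) (C-absorption m j) ⟩
  suc m C suc j + (suc m * (m C j) + suc m * (m C suc j))
    ≡⟨ cong (suc m C suc j +_) (*-distribˡ-+ (suc m) (m C j) _) ⟨
  suc m C suc j + suc m * (m C j + m C suc j)
    ≡⟨ cong (λ x → suc m C suc j + suc m * x) (C-pascal m j) ⟨
  suc m C suc j + suc m * (suc m C suc j)
    ≡⟨⟩
  suc (suc m) * (suc m C suc j)
    ∎
  where
  open ≡-Reasoning
  rearrange : ∀ a b c → suc a * b + c ≡ b + (a * b + c)
  rearrange = solve-∀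

C-unimodal : ∀ m j → 2 * suc j ≤ suc m → m C j ≤ m C suc j
C-unimodal m j 2[1+j]≤1+m = *-cancelˡ-≤ (suc j) (+-cancelʳ-≤ (suc j * (m C j)) _ _ (begin
  suc j * (m C j) + suc j * (m C j)          ≡⟨ double (suc j) (m C j) ⟩
  2 * suc j * (m C j)                        ≤⟨ *-monoˡ-≤ (m C j) 2[1+j]≤1+m ⟩
  suc m * (m C j)                            ≡⟨ C-absorption m j ⟨
  suc j * (suc m C suc j)                    ≡⟨ cong (suc j *_) (trans (C-pascal m j) (+-comm (m C j) _)) ⟩
  suc j * (m C suc j + m C j)                ≡⟨ *-distribˡ-+ (suc j) (m C suc j) (m C j) ⟩
  suc j * (m C suc j) + suc j * (m C j)      ∎))
  where
  open ≤-Reasoning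
  double : ∀ a b → a * b + a * b ≡ 2 * a * b
  double = solve-∀

[1+m]Cj≤2*mCj : ∀ m j → 2 * j ≤ suc m → suc m C j ≤ 2 * (m C j)
[1+m]Cj≤2*mCj m zero    _        = s≤s z≤n
[1+m]Cj≤2*mCj m (suc j) 2j≤1+m = begin
  suc m C suc j              ≡⟨ C-pascal m j ⟩
  m C j + m C suc j          ≤⟨ +-monoˡ-≤ (m C suc j) (C-unimodal m j 2j≤1+m) ⟩
  m C suc j + m C suc j      ≡⟨ cong (m C suc j +_) (+-identityʳ (m C suc j)) ⟨
  2 * (m C suc j)            ∎
  where open ≤-Reasoning

[c+m]Cj≤2^c*mCj : ∀ c m j → 2 * j ≤ suc m → (c + m) C j ≤ 2 ^ c * (m C j)
[c+m]Cj≤2^c*mCj zero    m j _      = ≤-reflexive (sym (+-identityʳ (m C j)))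
[c+m]Cj≤2^c*mCj (suc c) m j 2j≤1+m = begin
  suc (c + m) C j            ≤⟨ [1+m]Cj≤2*mCj (c + m) j (≤-trans 2j≤1+m (s≤s (m≤n+m m c))) ⟩
  2 * ((c + m) C j)          ≤⟨ *-monoʳ-≤ 2 ([c+m]Cj≤2^c*mCj c m j 2j≤1+m) ⟩
  2 * (2 ^ c * (m C j))      ≡⟨ *-assoc 2 (2 ^ c) (m C j) ⟨
  2 ^ suc c * (m C j)        ∎
  where open ≤-Reasoning

⊆∧∣∣≡⇒≡ : ∀ {n} {p q : Subset n} → p ⊆ q → ∣ p ∣ ≡ ∣ q ∣ → p ≡ q
⊆∧∣∣≡⇒≡ {p = []}          {[]}          _   _  = refl
⊆∧∣∣≡⇒≡ {p = inside ∷ p}  {inside ∷ q}  p⊆q eq = cong (inside ∷_) (⊆∧∣∣≡⇒≡ (drop-∷-⊆ p⊆q) (suc-injective eq))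
⊆∧∣∣≡⇒≡ {p = outside ∷ p} {outside ∷ q} p⊆q eq = cong (outside ∷_) (⊆∧∣∣≡⇒≡ (drop-∷-⊆ p⊆q) eq)
⊆∧∣∣≡⇒≡ {p = outside ∷ p} {inside ∷ q}  p⊆q eq = contradiction eq (<⇒≢ (s≤s (p⊆q⇒∣p∣≤∣q∣ (drop-∷-⊆ p⊆q))))
⊆∧∣∣≡⇒≡ {p = inside ∷ p}  {outside ∷ q} p⊆q eq with p⊆q here
... | ()

⊆-∩⁺ : ∀ {n} {t p q : Subset n} → t ⊆ p → t ⊆ q → t ⊆ p ∩ q
⊆-∩⁺ t⊆p t⊆q x∈t = x∈p∩q⁺ (t⊆p x∈t , t⊆q x∈t)

distinct⇒∣∩∣≤ : ∀ {n q} {x y : Subset n} → x ≢ y → ∣ x ∣ ≡ suc q → ∣ y ∣ ≡ suc q → ∣ x ∩ y ∣ ≤ q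
distinct⇒∣∩∣≤ {q = q} {x} {y} x≢y ∣x∣≡ ∣y∣≡ with ∣ x ∩ y ∣ ≤? q
... | yes ≤q = ≤q
... | no  ≰q = contradiction (trans (sym (≡-of x (p∩q⊆p x y) ∣x∣≡)) (≡-of y (p∩q⊆q x y) ∣y∣≡)) x≢y
  where
  ≡-of : ∀ z → x ∩ y ⊆ z → ∣ z ∣ ≡ suc q → x ∩ y ≡ z
  ≡-of z ⊆z ∣z∣≡ = ⊆∧∣∣≡⇒≡ ⊆z (trans (≤-antisym (≤-trans (p⊆q⇒∣p∣≤∣q∣ ⊆z) (≤-reflexive ∣z∣≡)) (≰⇒> ≰q)) (sym ∣z∣≡))

meets⇒Nonempty : ∀ {n} (a b : Subset n) → meets a b ≡ true → Nonempty (a ∩ b)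
meets⇒Nonempty []            []            ()
meets⇒Nonempty (inside  ∷ a) (inside  ∷ b) _  = zero , here
meets⇒Nonempty (inside  ∷ a) (outside ∷ b) ab with meets⇒Nonempty a b ab
... | x , x∈ = suc x , there x∈
meets⇒Nonempty (outside ∷ a) (_       ∷ b) ab with meets⇒Nonempty a b ab
... | x , x∈ = suc x , there x∈

Nonempty⇒meets : ∀ {n} (a b : Subset n) → Nonempty (a ∩ b) → meets a b ≡ true
Nonempty⇒meets (inside  ∷ a) (inside  ∷ b) _                  = refl
Nonempty⇒meets (inside  ∷ a) (outside ∷ b) (suc x , there x∈) = Nonempty⇒meets a b (x , x∈)
Nonempty⇒meets (outside ∷ a) (_       ∷ b) (suc x , there x∈) = Nonempty⇒meets a b (x , x∈)

¬meets⇒Empty : ∀ {n} (a b : Subset n) → meets a b ≡ false → Empty (a ∩ b)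
¬meets⇒Empty a b ab≡false ne with trans (sym ab≡false) (Nonempty⇒meets a b ne)
... | ()

meets≡not[⊆∁] : ∀ {n} (e S : Subset n) → meets e S ≡ not (does (e ⊆? ∁ S))
meets≡not[⊆∁] []            []            = refl
meets≡not[⊆∁] (inside  ∷ e) (inside  ∷ S) = refl
meets≡not[⊆∁] (inside  ∷ e) (outside ∷ S) = meets≡not[⊆∁] e S
meets≡not[⊆∁] (outside ∷ e) (_       ∷ S) = meets≡not[⊆∁] e S

isBetween : ∀ {n} → Subset n → Subset n → ℕ → Subset n → ℕ
isBetween P Q m T = ⟦ ∣ T ∣ ≡ᵇ m ⟧ * (𝟙 (P ⊆? T) * 𝟙 (T ⊆? Q))

#between : ∀ {n} → Subset n → Subset n → ℕ → ℕ
#between {n} P Q m = ∑ (allSubsets n) (isBetween P Q m)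

#between-≡ : ∀ {n} {P Q : Subset n} → P ⊆ Q → ∀ j → #between P Q (∣ P ∣ + j) ≡ (∣ Q ∣ ∸ ∣ P ∣) C j
#between-≡ {zero}  {[]}          {[]}          _   zero    = refl
#between-≡ {zero}  {[]}          {[]}          _   (suc j) = refl
#between-≡ {suc n} {outside ∷ P} {outside ∷ Q} P⊆Q j = begin
  #between (outside ∷ P) (outside ∷ Q) (∣ P ∣ + j)
    ≡⟨ ∑-allSubsets-suc (isBetween (outside ∷ P) (outside ∷ Q) (∣ P ∣ + j)) ⟩
  (∑[ T ∈ allSubsets n ] ⟦ suc ∣ T ∣ ≡ᵇ ∣ P ∣ + j ⟧ * (𝟙 (P ⊆? T) * 0)) + #between P Q (∣ P ∣ + j)
    ≡⟨ cong (_+ #between P Q (∣ P ∣ + j)) (∑-zero (allSubsets n) (λ T →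
         trans (cong (⟦ suc ∣ T ∣ ≡ᵇ ∣ P ∣ + j ⟧ *_) (*-zeroʳ (𝟙 (P ⊆? T)))) (*-zeroʳ ⟦ suc ∣ T ∣ ≡ᵇ ∣ P ∣ + j ⟧))) ⟩
  #between P Q (∣ P ∣ + j)                           ≡⟨ #between-≡ (drop-∷-⊆ P⊆Q) j ⟩
  (∣ Q ∣ ∸ ∣ P ∣) C j                                ∎
  where open ≡-Reasoning
#between-≡ {suc n} {inside ∷ P}  {inside ∷ Q}  P⊆Q j = begin
  #between (inside ∷ P) (inside ∷ Q) (suc ∣ P ∣ + j)
    ≡⟨ ∑-allSubsets-suc (isBetween (inside ∷ P) (inside ∷ Q) (suc ∣ P ∣ + j)) ⟩
  #between P Q (∣ P ∣ + j) + (∑[ T ∈ allSubsets n ] ⟦ ∣ T ∣ ≡ᵇ suc ∣ P ∣ + j ⟧ * 0)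
    ≡⟨ cong (#between P Q (∣ P ∣ + j) +_) (∑-zero (allSubsets n) (λ T → *-zeroʳ (⟦ ∣ T ∣ ≡ᵇ suc ∣ P ∣ + j ⟧))) ⟩
  #between P Q (∣ P ∣ + j) + 0                       ≡⟨ +-identityʳ _ ⟩
  #between P Q (∣ P ∣ + j)                           ≡⟨ #between-≡ (drop-∷-⊆ P⊆Q) j ⟩
  (∣ Q ∣ ∸ ∣ P ∣) C j                                ∎
  where open ≡-Reasoning
#between-≡ {suc n} {outside ∷ P} {inside ∷ Q}  P⊆Q j = begin
  #between (outside ∷ P) (inside ∷ Q) (∣ P ∣ + j)
    ≡⟨ ∑-allSubsets-suc (isBetween (outside ∷ P) (inside ∷ Q) (∣ P ∣ + j)) ⟩
  (∑[ T ∈ allSubsets n ] ⟦ suc ∣ T ∣ ≡ᵇ ∣ P ∣ + j ⟧ * (𝟙 (P ⊆? T) * 𝟙 (T ⊆? Q))) + #between P Q (∣ P ∣ + j)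
    ≡⟨ cong₂ _+_ (grow j) (#between-≡ P⊆Q′ j) ⟩
  pred-term j + (∣ Q ∣ ∸ ∣ P ∣) C j                  ≡⟨ pascal j ⟩
  (suc ∣ Q ∣ ∸ ∣ P ∣) C j                            ∎
  where
  open ≡-Reasoning
  P⊆Q′ = drop-∷-⊆ P⊆Q
  d = ∣ Q ∣ ∸ ∣ P ∣
  pred-term : ℕ → ℕ
  pred-term zero    = 0
  pred-term (suc j) = d C j
  too-small : ∀ T → ⟦ suc ∣ T ∣ ≡ᵇ ∣ P ∣ + 0 ⟧ * (𝟙 (P ⊆? T) * 𝟙 (T ⊆? Q)) ≡ 0
  too-small T with P ⊆? T
  ... | no  _   = *-zeroʳ (⟦ suc ∣ T ∣ ≡ᵇ ∣ P ∣ + 0 ⟧)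
  ... | yes P⊆T = cong (_* (1 * 𝟙 (T ⊆? Q))) (𝟙-no (suc ∣ T ∣ ≟ ∣ P ∣ + 0) (λ eq →
    <⇒≢ (s≤s (p⊆q⇒∣p∣≤∣q∣ P⊆T)) (sym (trans eq (+-identityʳ ∣ P ∣)))))
  grow : ∀ j → ∑[ T ∈ allSubsets n ] ⟦ suc ∣ T ∣ ≡ᵇ ∣ P ∣ + j ⟧ * (𝟙 (P ⊆? T) * 𝟙 (T ⊆? Q)) ≡ pred-term j
  grow zero    = ∑-zero (allSubsets n) too-small
  grow (suc j) = trans (∑-cong (allSubsets n) (λ T → cong (λ m → ⟦ suc ∣ T ∣ ≡ᵇ m ⟧ * (𝟙 (P ⊆? T) * 𝟙 (T ⊆? Q)))
                                                         (+-suc ∣ P ∣ j)))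
                       (#between-≡ P⊆Q′ j)
  pascal : ∀ j → pred-term j + d C j ≡ (suc ∣ Q ∣ ∸ ∣ P ∣) C j
  pascal zero    = refl
  pascal (suc j) = trans (sym (C-pascal d j)) (cong (_C suc j) (sym (+-∸-assoc 1 (p⊆q⇒∣p∣≤∣q∣ P⊆Q′))))
#between-≡ {suc n} {inside ∷ P}  {outside ∷ Q} P⊆Q j with P⊆Q here
... | ()

#subsets≡ : ∀ {n} (Q : Subset n) m → ∑[ T ∈ allSubsets n ] ⟦ ∣ T ∣ ≡ᵇ m ⟧ * 𝟙 (T ⊆? Q) ≡ ∣ Q ∣ C m
#subsets≡ {n} Q m = begin
  ∑[ T ∈ allSubsets n ] ⟦ ∣ T ∣ ≡ᵇ m ⟧ * 𝟙 (T ⊆? Q)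
    ≡⟨ ∑-cong (allSubsets n) (λ T → cong (⟦ ∣ T ∣ ≡ᵇ m ⟧ *_) (trans (sym (*-identityˡ (𝟙 (T ⊆? Q))))
                                      (cong (_* 𝟙 (T ⊆? Q)) (sym (𝟙-yes (⊥ ⊆? T) ⊥⊆))))) ⟩
  #between ⊥ Q m                    ≡⟨ cong (#between ⊥ Q) (cong (_+ m) (∣⊥∣≡0 n)) ⟨
  #between ⊥ Q (∣ ⊥ {n} ∣ + m)      ≡⟨ #between-≡ {P = ⊥} {Q} ⊥⊆ m ⟩
  (∣ Q ∣ ∸ ∣ ⊥ {n} ∣) C m           ≡⟨ cong (λ x → (∣ Q ∣ ∸ x) C m) (∣⊥∣≡0 n) ⟩
  ∣ Q ∣ C m                         ∎
  where open ≡-Reasoning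

#between-suc≡ : ∀ {n} {P Q : Subset n} → P ⊆ Q → #between P Q (suc ∣ P ∣) ≡ ∣ Q ∣ ∸ ∣ P ∣
#between-suc≡ {P = P} {Q} P⊆Q = begin
  #between P Q (suc ∣ P ∣)          ≡⟨ cong (#between P Q) (+-comm 1 ∣ P ∣) ⟩
  #between P Q (∣ P ∣ + 1)          ≡⟨ #between-≡ P⊆Q 1 ⟩
  (∣ Q ∣ ∸ ∣ P ∣) C 1               ≡⟨ nC1≡n (∣ Q ∣ ∸ ∣ P ∣) ⟩
  ∣ Q ∣ ∸ ∣ P ∣                     ∎
  where open ≡-Reasoning

degree : ∀ {n} → Hypergraph n → Subset n → ℕ
degree {n} H T = ∑[ e ∈ allSubsets n ] ⟦ H e ⟧ * 𝟙 (T ⊆? e)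

-- ∑ over q-sets T of C(deg T, k): a sunflower with a q-element kernel T is a k-set of edges through T.
starSum : ∀ {n} → ℕ → ℕ → Hypergraph n → ℕ
starSum {n} k q H = ∑[ T ∈ allSubsets n ] ⟦ ∣ T ∣ ≡ᵇ q ⟧ * (degree H T C k)

#edges : ∀ {n} → Hypergraph n → ℕ
#edges {n} H = ∑[ e ∈ allSubsets n ] ⟦ H e ⟧

double-counting : ∀ {n} q (w : Subset n → ℕ) →
  (∑[ T ∈ allSubsets n ] ⟦ ∣ T ∣ ≡ᵇ q ⟧ * (∑[ e ∈ allSubsets n ] w e * 𝟙 (T ⊆? e)))
    ≡ (∑[ e ∈ allSubsets n ] w e * (∣ e ∣ C q))
double-counting {n} q w = begin
  (∑[ T ∈ 𝒫 ] ⟦ ∣ T ∣ ≡ᵇ q ⟧ * (∑[ e ∈ 𝒫 ] w e * 𝟙 (T ⊆? e)))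
    ≡⟨ ∑-cong 𝒫 (λ T → sym (∑-*ˡ 𝒫 (⟦ ∣ T ∣ ≡ᵇ q ⟧) _)) ⟩
  (∑[ T ∈ 𝒫 ] ∑[ e ∈ 𝒫 ] ⟦ ∣ T ∣ ≡ᵇ q ⟧ * (w e * 𝟙 (T ⊆? e)))
    ≡⟨ ∑-swap 𝒫 𝒫 _ ⟩
  (∑[ e ∈ 𝒫 ] ∑[ T ∈ 𝒫 ] ⟦ ∣ T ∣ ≡ᵇ q ⟧ * (w e * 𝟙 (T ⊆? e)))
    ≡⟨ ∑-cong 𝒫 (λ e → trans (∑-cong 𝒫 (λ T → x*[y*z]≡y*[x*z] (⟦ ∣ T ∣ ≡ᵇ q ⟧) (w e) _)) (∑-*ˡ 𝒫 (w e) _)) ⟩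
  (∑[ e ∈ 𝒫 ] w e * (∑[ T ∈ 𝒫 ] ⟦ ∣ T ∣ ≡ᵇ q ⟧ * 𝟙 (T ⊆? e)))
    ≡⟨ ∑-cong 𝒫 (λ e → cong (w e *_) (#subsets≡ e q)) ⟩
  (∑[ e ∈ 𝒫 ] w e * (∣ e ∣ C q))
    ∎
  where
  open ≡-Reasoning
  𝒫 = allSubsets n
  x*[y*z]≡y*[x*z] : ∀ x y z → x * (y * z) ≡ y * (x * z)
  x*[y*z]≡y*[x*z] = solve-∀

double-counting-uniform : ∀ {n} q (w : Subset n → ℕ) → (∀ e → 0 < w e → ∣ e ∣ ≡ suc q) →
  (∑[ T ∈ allSubsets n ] ⟦ ∣ T ∣ ≡ᵇ q ⟧ * (∑[ e ∈ allSubsets n ] w e * 𝟙 (T ⊆? e)))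
    ≡ suc q * (∑[ e ∈ allSubsets n ] w e)
double-counting-uniform {n} q w uniform =
  trans (double-counting q w) (trans (∑-cong (allSubsets n) weight) (∑-*ˡ (allSubsets n) (suc q) w))
  where
  weight : ∀ e → w e * (∣ e ∣ C q) ≡ suc q * w e
  weight e with w e in w≡
  ... | zero  = sym (*-zeroʳ (suc q))
  ... | suc m = begin
    suc m * (∣ e ∣ C q)     ≡⟨ cong (λ x → suc m * (x C q)) (uniform e (subst (0 <_) (sym w≡) z<s)) ⟩
    suc m * (suc q C q)     ≡⟨ cong (suc m *_) ([1+n]Cn≡1+n q) ⟩
    suc m * suc q           ≡⟨ *-comm (suc m) (suc q) ⟩
    suc q * suc m           ∎
    where open ≡-Reasoning

⟦⟧>0 : ∀ {b} → 0 < ⟦ b ⟧ → b ≡ true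
⟦⟧>0 {true} _ = refl

starSum-1 : ∀ {n} q (H : Hypergraph n) → Uniform (suc q) H → starSum 1 q H ≡ suc q * #edges H
starSum-1 {n} q H uniform = begin
  starSum 1 q H
    ≡⟨ ∑-cong (allSubsets n) (λ T → cong (⟦ ∣ T ∣ ≡ᵇ q ⟧ *_) (nC1≡n (degree H T))) ⟩
  (∑[ T ∈ allSubsets n ] ⟦ ∣ T ∣ ≡ᵇ q ⟧ * degree H T)
    ≡⟨ double-counting-uniform q (λ e → ⟦ H e ⟧) (λ e pos → uniform e (⟦⟧>0 pos)) ⟩
  suc q * #edges H
    ∎
  where open ≡-Reasoning

allSubsets-Unique : ∀ n → Unique (allSubsets n)
allSubsets-Unique zero    = [] ∷ []
allSubsets-Unique (suc n) = AllPairs.++⁺ (prefix inside) (prefix outside)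
  (All.map⁺ (All.universal (λ _ → All.map⁺ (All.universal (λ _ ()) (allSubsets n))) (allSubsets n)))
  where
  prefix : ∀ b → Unique (map (b ∷_) (allSubsets n))
  prefix b = AllPairs.map⁺ (AllPairs.map (λ x≢y eq → x≢y (∷-injectiveʳ eq)) (allSubsets-Unique n))

module _ {A : Set} where

  combinations-All : ∀ {P : A → Set} i {xs} → All P xs → All (All P) (combinations i xs)
  combinations-All zero    _           = [] ∷ []
  combinations-All (suc i) []          = []
  combinations-All (suc i) (px ∷ pxs) =
    All.++⁺ (All.map⁺ (All.map (px ∷_) (combinations-All i pxs))) (combinations-All (suc i) pxs)

  combinations-Unique : ∀ i {xs : List A} → Unique xs → All Unique (combinations i xs)
  combinations-Unique zero    _            = [] ∷ []
  combinations-Unique (suc i) []           = []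
  combinations-Unique (suc i) (x∉xs ∷ xs!) =
    All.++⁺ (All.map⁺ (All.zipWith (λ (x∉c , c!) → x∉c ∷ c!) (combinations-All i x∉xs , combinations-Unique i xs!)))
            (combinations-Unique (suc i) xs!)

  combinations-length : ∀ i (xs : List A) → All (λ c → length c ≡ i) (combinations i xs)
  combinations-length zero    _        = refl ∷ []
  combinations-length (suc i) []       = []
  combinations-length (suc i) (x ∷ xs) =
    All.++⁺ (All.map⁺ (All.map (cong suc) (combinations-length i xs))) (combinations-length (suc i) xs)

  ∑-combinations : ∀ (p : A → Bool) i xs →
    (∑[ c ∈ combinations i xs ] ⟦ allB p c ⟧) ≡ (∑[ x ∈ xs ] ⟦ p x ⟧) C i
  ∑-combinations p zero    xs       = refl
  ∑-combinations p (suc i) []       = refl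
  ∑-combinations p (suc i) (x ∷ xs) = begin
    (∑[ c ∈ map (x ∷_) (combinations i xs) ++ combinations (suc i) xs ] ⟦ allB p c ⟧)
      ≡⟨ ∑-++ (map (x ∷_) (combinations i xs)) _ (λ c → ⟦ allB p c ⟧) ⟩
    (∑[ c ∈ map (x ∷_) (combinations i xs) ] ⟦ allB p c ⟧) + (∑[ c ∈ combinations (suc i) xs ] ⟦ allB p c ⟧)
      ≡⟨ cong₂ _+_ (∑-map (x ∷_) (combinations i xs) (λ c → ⟦ allB p c ⟧)) (∑-combinations p (suc i) xs) ⟩
    (∑[ c ∈ combinations i xs ] ⟦ p x ∧ allB p c ⟧) + S C suc i
      ≡⟨ cong (_+ S C suc i) (with-head (p x)) ⟩
    ⟦ p x ⟧ * (S C i) + S C suc i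
      ≡⟨ pascal (p x) ⟩
    (⟦ p x ⟧ + S) C suc i
      ∎
    where
    open ≡-Reasoning
    S = ∑[ x ∈ xs ] ⟦ p x ⟧
    with-head : ∀ b → (∑[ c ∈ combinations i xs ] ⟦ b ∧ allB p c ⟧) ≡ ⟦ b ⟧ * (S C i)
    with-head true  = trans (∑-combinations p i xs) (sym (+-identityʳ (S C i)))
    with-head false = ∑-zero (combinations i xs) (λ _ → refl)
    pascal : ∀ b → ⟦ b ⟧ * (S C i) + S C suc i ≡ (⟦ b ⟧ + S) C suc i
    pascal true  = trans (cong (_+ S C suc i) (+-identityʳ (S C i))) (sym (C-pascal S i))
    pascal false = refl

==S-≡ : ∀ {n} {a b : Subset n} → a ≡ b → (a ==S b) ≡ true
==S-≡ {a = a} {b} = dec-true (≡-dec _≟ᵇ_ a b)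

==S⇒≡ : ∀ {n} {a b : Subset n} → (a ==S b) ≡ true → a ≡ b
==S⇒≡ {a = a} {b} = does⇒ (≡-dec _≟ᵇ_ a b)

module _ {A : Set} {f g : A → Bool} where

  allB-cong : ∀ {xs} → All (λ x → f x ≡ g x) xs → allB f xs ≡ allB g xs
  allB-cong []           = refl
  allB-cong (fx≡gx ∷ eq) = cong₂ _∧_ fx≡gx (allB-cong eq)

allB-true : ∀ {A : Set} {f : A → Bool} {xs} → All (λ x → f x ≡ true) xs → allB f xs ≡ true
allB-true []           = refl
allB-true (fx≡true ∷ h) rewrite fx≡true = allB-true h

allB-true⁻ : ∀ {A : Set} (f : A → Bool) xs → allB f xs ≡ true → All (λ x → f x ≡ true) xs
allB-true⁻ f []       _ = []
allB-true⁻ f (x ∷ xs) h with f x in fx≡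
... | true = fx≡ ∷ allB-true⁻ f xs h

module _ {n q : ℕ} where

  Size : Subset n → Set
  Size e = ∣ e ∣ ≡ suc q

  -- Two distinct (q+1)-sets meet in at most q points, so a q-set U inside x is
  -- their intersection exactly when it lies in the other one.
  ∩==S-kernel : ∀ {U x z : Subset n} → U ⊆ x → ∣ U ∣ ≡ q → Size x → Size z → x ≢ z →
    ((x ∩ z) ==S U) ≡ does (U ⊆? z)
  ∩==S-kernel {U} {x} {z} U⊆x ∣U∣≡q ∣x∣ ∣z∣ x≢z with U ⊆? z
  ... | yes U⊆z = ==S-≡ (sym (⊆∧∣∣≡⇒≡ U⊆x∩z (≤-antisym (p⊆q⇒∣p∣≤∣q∣ U⊆x∩z)
                    (subst (∣ x ∩ z ∣ ≤_) (sym ∣U∣≡q) (distinct⇒∣∩∣≤ x≢z ∣x∣ ∣z∣)))))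
    where U⊆x∩z = ⊆-∩⁺ U⊆x U⊆z
  ... | no U⊈z with (x ∩ z) ==S U in eq
  ...   | false = refl
  ...   | true  = ⊥-elim (U⊈z (λ {i} i∈U → p∩q⊆q x z (subst (i ∈_) (sym (==S⇒≡ eq)) i∈U)))

  kernel-tests : ∀ {U x : Subset n} {zs} → U ⊆ x → ∣ U ∣ ≡ q → Size x → All (x ≢_) zs → All Size zs →
    All (λ z → ((x ∩ z) ==S U) ≡ does (U ⊆? z)) zs
  kernel-tests U⊆x ∣U∣≡q ∣x∣ x∉zs ∣zs∣ =
    All.zipWith (λ (x≢z , ∣z∣) → ∩==S-kernel U⊆x ∣U∣≡q ∣x∣ ∣z∣ x≢z) (x∉zs , ∣zs∣)

  pairwiseMeet-true : ∀ {U : Subset n} {zs} → ∣ U ∣ ≡ q → All (U ⊆_) zs → Unique zs → All Size zs →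
    pairwiseMeet U zs ≡ true
  pairwiseMeet-true ∣U∣≡q []            []            []            = refl
  pairwiseMeet-true {U} {z ∷ zs} ∣U∣≡q (U⊆z ∷ U⊆zs) (z∉zs ∷ zs!) (∣z∣ ∷ ∣zs∣) = cong₂ _∧_
    (allB-true (tests-pass (kernel-tests U⊆z ∣U∣≡q ∣z∣ z∉zs ∣zs∣) U⊆zs))
    (pairwiseMeet-true ∣U∣≡q U⊆zs zs! ∣zs∣)
    where
    tests-pass : ∀ {ws} → All (λ w → ((z ∩ w) ==S U) ≡ does (U ⊆? w)) ws → All (U ⊆_) ws →
      All (λ w → ((z ∩ w) ==S U) ≡ true) ws
    tests-pass          []         []           = []
    tests-pass {w ∷ _} (eq ∷ eqs) (U⊆w ∷ U⊆ws) = trans eq (dec-true (U ⊆? w) U⊆w) ∷ tests-pass eqs U⊆ws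

  isSunflower≡ : ∀ {x y : Subset n} {zs} → Unique (x ∷ y ∷ zs) → All Size (x ∷ y ∷ zs) →
    isSunflower q (x ∷ y ∷ zs) ≡ (∣ x ∩ y ∣ ≡ᵇ q) ∧ allB (λ z → does (x ∩ y ⊆? z)) zs
  isSunflower≡ {x} {y} {zs} ((_ ∷ x∉zs) ∷ (y∉zs ∷ zs!)) (∣x∣ ∷ ∣y∣ ∷ ∣zs∣) with ∣ x ∩ y ∣ ≡ᵇ q in ∣U∣≡ᵇq
  ... | false = refl
  ... | true
    rewrite ==S-≡ {a = x ∩ y} refl
          | allB-cong (kernel-tests (p∩q⊆p x y) (≡ᵇ-true⇒≡ ∣U∣≡ᵇq) ∣x∣ x∉zs ∣zs∣)
          | allB-cong (kernel-tests (p∩q⊆q x y) (≡ᵇ-true⇒≡ ∣U∣≡ᵇq) ∣y∣ y∉zs ∣zs∣)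
    with allB (λ z → does (x ∩ y ⊆? z)) zs in all⊇U
  ...   | false = refl
  ...   | true  = pairwiseMeet-true (≡ᵇ-true⇒≡ ∣U∣≡ᵇq)
                    (All.map (does⇒ (x ∩ y ⊆? _)) (allB-true⁻ (λ z → does (x ∩ y ⊆? z)) zs all⊇U)) zs! ∣zs∣

  allB-⊆-cons₂ : ∀ (T x y : Subset n) zs →
    ⟦ allB (λ e → does (T ⊆? e)) (x ∷ y ∷ zs) ⟧ ≡ 𝟙 (T ⊆? x ∩ y) * ⟦ allB (λ e → does (T ⊆? e)) zs ⟧
  allB-⊆-cons₂ T x y zs with T ⊆? x | T ⊆? y | T ⊆? x ∩ y
  ... | yes _   | yes _   | yes _    = sym (+-identityʳ _)
  ... | yes T⊆x | yes T⊆y | no T⊈x∩y = ⊥-elim (T⊈x∩y (⊆-∩⁺ T⊆x T⊆y))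
  ... | no T⊈x  | _       | yes T⊆x∩y = ⊥-elim (T⊈x (λ i∈T → p∩q⊆p x y (T⊆x∩y i∈T)))
  ... | yes _   | no T⊈y  | yes T⊆x∩y = ⊥-elim (T⊈y (λ i∈T → p∩q⊆q x y (T⊆x∩y i∈T)))
  ... | no _    | _       | no _     = refl
  ... | yes _   | no _    | no _     = refl

  ∑-kernels : ∀ (x y : Subset n) zs → ∣ x ∩ y ∣ ≤ q →
    (∑[ T ∈ allSubsets n ] ⟦ ∣ T ∣ ≡ᵇ q ⟧ * ⟦ allB (λ e → does (T ⊆? e)) (x ∷ y ∷ zs) ⟧)
      ≡ ⟦ (∣ x ∩ y ∣ ≡ᵇ q) ∧ allB (λ z → does (x ∩ y ⊆? z)) zs ⟧
  ∑-kernels x y zs ∣U∣≤q =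
    trans (∑-cong 𝒫 (λ T → cong (⟦ ∣ T ∣ ≡ᵇ q ⟧ *_) (allB-⊆-cons₂ T x y zs))) (by-size (∣ U ∣ ≡ᵇ q) refl)
    where
    𝒫 = allSubsets n
    U = x ∩ y
    all⊇ : Subset n → Bool
    all⊇ T = allB (λ e → does (T ⊆? e)) zs
    only-U : ∣ U ∣ ≡ q → ∀ T → ⟦ ∣ T ∣ ≡ᵇ q ⟧ * (𝟙 (T ⊆? U) * ⟦ all⊇ T ⟧) ≡ ⟦ ∣ T ∣ ≡ᵇ q ⟧ * 𝟙 (T ⊆? U) * ⟦ all⊇ U ⟧
    only-U ∣U∣≡q T with ∣ T ∣ ≡ᵇ q in ∣T∣≡ᵇq | T ⊆? U
    ... | false | _      = refl
    ... | true  | no _   = refl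
    ... | true  | yes T⊆U rewrite ⊆∧∣∣≡⇒≡ T⊆U (trans (≡ᵇ-true⇒≡ ∣T∣≡ᵇq) (sym ∣U∣≡q)) = sym (*-assoc 1 1 _)
    by-size : ∀ b → (∣ U ∣ ≡ᵇ q) ≡ b →
      (∑[ T ∈ 𝒫 ] ⟦ ∣ T ∣ ≡ᵇ q ⟧ * (𝟙 (T ⊆? U) * ⟦ all⊇ T ⟧)) ≡ ⟦ b ∧ all⊇ U ⟧
    by-size true ∣U∣≡ᵇq = begin
      (∑[ T ∈ 𝒫 ] ⟦ ∣ T ∣ ≡ᵇ q ⟧ * (𝟙 (T ⊆? U) * ⟦ all⊇ T ⟧))   ≡⟨ ∑-cong 𝒫 (only-U ∣U∣≡q) ⟩
      (∑[ T ∈ 𝒫 ] ⟦ ∣ T ∣ ≡ᵇ q ⟧ * 𝟙 (T ⊆? U) * ⟦ all⊇ U ⟧)     ≡⟨ ∑-*ʳ 𝒫 (⟦ all⊇ U ⟧) _ ⟩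
      (∑[ T ∈ 𝒫 ] ⟦ ∣ T ∣ ≡ᵇ q ⟧ * 𝟙 (T ⊆? U)) * ⟦ all⊇ U ⟧     ≡⟨ cong (_* ⟦ all⊇ U ⟧) (#subsets≡ U q) ⟩
      (∣ U ∣ C q) * ⟦ all⊇ U ⟧                                     ≡⟨ cong (λ m → (m C q) * ⟦ all⊇ U ⟧) ∣U∣≡q ⟩
      (q C q) * ⟦ all⊇ U ⟧                                         ≡⟨ cong (_* ⟦ all⊇ U ⟧) (nCn≡1 q) ⟩
      1 * ⟦ all⊇ U ⟧                                               ≡⟨ *-identityˡ _ ⟩
      ⟦ all⊇ U ⟧                                                   ∎
      where
      open ≡-Reasoning
      ∣U∣≡q = ≡ᵇ-true⇒≡ ∣U∣≡ᵇq
    by-size false ∣U∣≢q = n≤0⇒n≡0 (begin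
      (∑[ T ∈ 𝒫 ] ⟦ ∣ T ∣ ≡ᵇ q ⟧ * (𝟙 (T ⊆? U) * ⟦ all⊇ T ⟧))
        ≤⟨ ∑-mono-≤ 𝒫 (λ T → *-monoʳ-≤ ⟦ ∣ T ∣ ≡ᵇ q ⟧ (≤-trans (*-monoʳ-≤ (𝟙 (T ⊆? U)) (⟦⟧≤1 (all⊇ T)))
                                                              (≤-reflexive (*-identityʳ _)))) ⟩
      (∑[ T ∈ 𝒫 ] ⟦ ∣ T ∣ ≡ᵇ q ⟧ * 𝟙 (T ⊆? U))                  ≡⟨ #subsets≡ U q ⟩
      ∣ U ∣ C q                                                    ≡⟨ k>n⇒nCk≡0 ∣U∣<q ⟩
      0                                                            ∎)
      where
      open ≤-Reasoning
      ∣U∣<q = ≤∧≢⇒< ∣U∣≤q (¬does⇒ (∣ U ∣ ≟ q) ∣U∣≢q)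

module _ {n : ℕ} (H : Hypergraph n) where

  edges-Unique : Unique (edges H)
  edges-Unique = Unique.filter⁺ (λ e → H e ≟ᵇ true) (allSubsets-Unique n)

  edges-All : All (λ e → H e ≡ true) (edges H)
  edges-All = All.all-filter (λ e → H e ≟ᵇ true) (allSubsets n)

  ∑-edges : ∀ f → (∑[ e ∈ edges H ] f e) ≡ (∑[ e ∈ allSubsets n ] ⟦ H e ⟧ * f e)
  ∑-edges f = trans (∑-filter (λ e → H e ≟ᵇ true) (allSubsets n) f)
                    (∑-cong (allSubsets n) (λ e → cong (_* f e) (𝟙[≟true] (H e))))

  numSunflowers≡∑ : ∀ k r → numSunflowers k r H ≡ (∑[ c ∈ combinations k (edges H) ] ⟦ isSunflower (r ∸ 1) c ⟧)
  numSunflowers≡∑ k r = trans (length-filter (λ c → isSunflower (r ∸ 1) c ≟ᵇ true) (combinations k (edges H)))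
    (∑-cong (combinations k (edges H)) (λ c → 𝟙[≟true] (isSunflower (r ∸ 1) c)))

  numSunflowers-1 : ∀ r → numSunflowers 1 r H ≡ #edges H
  numSunflowers-1 r = begin
    numSunflowers 1 r H
      ≡⟨ numSunflowers≡∑ 1 r ⟩
    (∑[ c ∈ combinations 1 (edges H) ] ⟦ isSunflower (r ∸ 1) c ⟧)
      ≡⟨ ∑-cong-All (All.map (λ {c} → singleton {c}) (combinations-length 1 (edges H))) ⟩
    (∑[ c ∈ combinations 1 (edges H) ] ⟦ allB (λ _ → true) c ⟧)
      ≡⟨ ∑-combinations (λ _ → true) 1 (edges H) ⟩
    (∑[ e ∈ edges H ] 1) C 1
      ≡⟨ nC1≡n _ ⟩
    (∑[ e ∈ edges H ] 1)
      ≡⟨ ∑-edges (λ _ → 1) ⟩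
    (∑[ e ∈ allSubsets n ] ⟦ H e ⟧ * 1)
      ≡⟨ ∑-cong (allSubsets n) (λ e → *-identityʳ ⟦ H e ⟧) ⟩
    #edges H
      ∎
    where
    open ≡-Reasoning
    singleton : ∀ {c} → length c ≡ 1 → ⟦ isSunflower (r ∸ 1) c ⟧ ≡ ⟦ allB (λ _ → true) c ⟧
    singleton {_ ∷ []} _ = refl

  numSunflowers≡starSum : ∀ j q → Uniform (suc q) H → numSunflowers (2 + j) (suc q) H ≡ starSum (2 + j) q H
  numSunflowers≡starSum j q uniform = begin
    numSunflowers k (suc q) H
      ≡⟨ numSunflowers≡∑ k (suc q) ⟩
    (∑[ c ∈ 𝒞 ] ⟦ isSunflower q c ⟧)
      ≡⟨ ∑-cong-All (All.map kernel-count (All.zip (combinations-Unique k edges-Unique ,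
                       All.zip (combinations-All k (All.map (uniform _) edges-All) , combinations-length k (edges H))))) ⟩
    (∑[ c ∈ 𝒞 ] ∑[ T ∈ 𝒫 ] ⟦ ∣ T ∣ ≡ᵇ q ⟧ * ⟦ allB (λ e → does (T ⊆? e)) c ⟧)
      ≡⟨ ∑-swap 𝒞 𝒫 _ ⟩
    (∑[ T ∈ 𝒫 ] ∑[ c ∈ 𝒞 ] ⟦ ∣ T ∣ ≡ᵇ q ⟧ * ⟦ allB (λ e → does (T ⊆? e)) c ⟧)
      ≡⟨ ∑-cong 𝒫 (λ T → ∑-*ˡ 𝒞 ⟦ ∣ T ∣ ≡ᵇ q ⟧ _) ⟩
    (∑[ T ∈ 𝒫 ] ⟦ ∣ T ∣ ≡ᵇ q ⟧ * (∑[ c ∈ 𝒞 ] ⟦ allB (λ e → does (T ⊆? e)) c ⟧))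
      ≡⟨ ∑-cong 𝒫 (λ T → cong (⟦ ∣ T ∣ ≡ᵇ q ⟧ *_) (trans (∑-combinations _ k (edges H))
                                                     (cong (_C k) (∑-edges (λ e → 𝟙 (T ⊆? e)))))) ⟩
    starSum k q H
      ∎
    where
    open ≡-Reasoning
    k = 2 + j
    𝒞 = combinations k (edges H)
    𝒫 = allSubsets n
    kernel-count : ∀ {c} → Unique c × All (λ e → ∣ e ∣ ≡ suc q) c × length c ≡ k →
      ⟦ isSunflower q c ⟧ ≡ (∑[ T ∈ 𝒫 ] ⟦ ∣ T ∣ ≡ᵇ q ⟧ * ⟦ allB (λ e → does (T ⊆? e)) c ⟧)
    kernel-count {x ∷ y ∷ zs} (c!@((x≢y ∷ _) ∷ _) , ∣c∣@(∣x∣ ∷ ∣y∣ ∷ _) , _) = begin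
      ⟦ isSunflower q (x ∷ y ∷ zs) ⟧                                    ≡⟨ cong ⟦_⟧ (isSunflower≡ c! ∣c∣) ⟩
      ⟦ (∣ x ∩ y ∣ ≡ᵇ q) ∧ allB (λ z → does (x ∩ y ⊆? z)) zs ⟧          ≡⟨ ∑-kernels x y zs (distinct⇒∣∩∣≤ x≢y ∣x∣ ∣y∣) ⟨
      (∑[ T ∈ 𝒫 ] ⟦ ∣ T ∣ ≡ᵇ q ⟧ * ⟦ allB (λ e → does (T ⊆? e)) (x ∷ y ∷ zs) ⟧) ∎

hitting : ∀ {n} → ℕ → Subset n → Hypergraph n
hitting r S e = (∣ e ∣ ≡ᵇ r) ∧ meets e S

hitting-uniform : ∀ {n} r (S : Subset n) → Uniform r (hitting r S)
hitting-uniform r S e hit = ≡ᵇ-true⇒≡ (∧-conicalˡ _ _ hit)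

-- The starSum of the (q+1)-sets hitting a σ-set S: the q-sets meeting S have degree n − q,
-- the C(n−σ, q) others have degree σ.
hittingValue : ℕ → ℕ → ℕ → ℕ → ℕ
hittingValue n q k σ = ((n ∸ q) C k) * (n C q ∸ (n ∸ σ) C q) + (σ C k) * ((n ∸ σ) C q)

module _ {n : ℕ} (q : ℕ) where

  degree≤ : (H : Hypergraph n) → Uniform (suc q) H → ∀ {T} → ∣ T ∣ ≡ q → degree H T ≤ n ∸ q
  degree≤ H uniform {T} ∣T∣≡q = begin
    degree H T                 ≤⟨ ∑-mono-≤ (allSubsets n) edge-of-size ⟩
    #between T ⊤ (suc q)       ≡⟨ cong (λ m → #between T ⊤ (suc m)) ∣T∣≡q ⟨
    #between T ⊤ (suc ∣ T ∣)   ≡⟨ #between-suc≡ {P = T} {⊤} ⊆⊤ ⟩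
    ∣ ⊤ {n} ∣ ∸ ∣ T ∣              ≡⟨ cong₂ _∸_ (∣⊤∣≡n n) ∣T∣≡q ⟩
    n ∸ q                      ∎
    where
    open ≤-Reasoning
    edge-of-size : ∀ e → ⟦ H e ⟧ * 𝟙 (T ⊆? e) ≤ isBetween T ⊤ (suc q) e
    edge-of-size e with H e in He
    ... | false = z≤n
    ... | true rewrite uniform e He | 𝟙-yes (suc q ≟ suc q) refl | 𝟙-yes (e ⊆? ⊤) ⊆⊤ =
      ≤-reflexive (sym (cong (_+ 0) (*-identityʳ _)))

  module _ (S : Subset n) where

    degree-hitting+#between : ∀ T →
      degree (hitting (suc q) S) T + #between T (∁ S) (suc q) ≡ #between T ⊤ (suc q)
    degree-hitting+#between T =
      trans (sym (∑-+ (allSubsets n) (λ e → ⟦ hitting (suc q) S e ⟧ * 𝟙 (T ⊆? e)) (isBetween T (∁ S) (suc q))))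
            (∑-cong (allSubsets n) split)
      where
      split : ∀ e → ⟦ hitting (suc q) S e ⟧ * 𝟙 (T ⊆? e) + isBetween T (∁ S) (suc q) e ≡ isBetween T ⊤ (suc q) e
      split e rewrite meets≡not[⊆∁] e S | 𝟙-yes (e ⊆? ⊤) ⊆⊤ with ∣ e ∣ ≡ᵇ suc q | T ⊆? e | e ⊆? ∁ S
      ... | false | _     | _     = refl
      ... | true  | no  _ | yes _ = refl
      ... | true  | no  _ | no  _ = refl
      ... | true  | yes _ | yes _ = refl
      ... | true  | yes _ | no  _ = refl

    degree-hitting-meeting : ∀ {T} → ¬ (T ⊆ ∁ S) → ∣ T ∣ ≡ q → degree (hitting (suc q) S) T ≡ n ∸ q
    degree-hitting-meeting {T} T⊈∁S ∣T∣≡q = begin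
      degree (hitting (suc q) S) T                              ≡⟨ +-identityʳ _ ⟨
      degree (hitting (suc q) S) T + 0
        ≡⟨ cong (degree (hitting (suc q) S) T +_) (∑-zero (allSubsets n) none) ⟨
      degree (hitting (suc q) S) T + #between T (∁ S) (suc q)   ≡⟨ degree-hitting+#between T ⟩
      #between T ⊤ (suc q)                                      ≡⟨ cong (λ m → #between T ⊤ (suc m)) ∣T∣≡q ⟨
      #between T ⊤ (suc ∣ T ∣)                                  ≡⟨ #between-suc≡ {P = T} {⊤} ⊆⊤ ⟩
      ∣ ⊤ {n} ∣ ∸ ∣ T ∣                                             ≡⟨ cong₂ _∸_ (∣⊤∣≡n n) ∣T∣≡q ⟩
      n ∸ q                                                     ∎
      where
      open ≡-Reasoning
      none : ∀ e → isBetween T (∁ S) (suc q) e ≡ 0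
      none e with T ⊆? e | e ⊆? ∁ S
      ... | no  _   | _       = *-zeroʳ ⟦ ∣ e ∣ ≡ᵇ suc q ⟧
      ... | yes _   | no  _   = *-zeroʳ ⟦ ∣ e ∣ ≡ᵇ suc q ⟧
      ... | yes T⊆e | yes e⊆∁S = ⊥-elim (T⊈∁S (λ i∈T → e⊆∁S (T⊆e i∈T)))

    degree-hitting-avoiding : ∀ {T} → T ⊆ ∁ S → ∣ T ∣ ≡ q → q + ∣ S ∣ ≤ n →
      degree (hitting (suc q) S) T ≡ ∣ S ∣
    degree-hitting-avoiding {T} T⊆∁S ∣T∣≡q q+∣S∣≤n = +-cancelʳ-≡ _ _ _ (begin
      degree (hitting (suc q) S) T + #between T (∁ S) (suc q)   ≡⟨ degree-hitting+#between T ⟩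
      #between T ⊤ (suc q)                                      ≡⟨ cong (λ m → #between T ⊤ (suc m)) ∣T∣≡q ⟨
      #between T ⊤ (suc ∣ T ∣)                                  ≡⟨ #between-suc≡ {P = T} {⊤} ⊆⊤ ⟩
      ∣ ⊤ {n} ∣ ∸ ∣ T ∣                                             ≡⟨ cong₂ _∸_ (∣⊤∣≡n n) ∣T∣≡q ⟩
      n ∸ q                                                     ≡⟨ cong (_∸ q) (m+[n∸m]≡n ∣S∣≤n) ⟨
      ∣ S ∣ + (n ∸ ∣ S ∣) ∸ q                                   ≡⟨ +-∸-assoc ∣ S ∣ q≤n∸∣S∣ ⟩
      ∣ S ∣ + (n ∸ ∣ S ∣ ∸ q)                                   ≡⟨ cong (λ m → ∣ S ∣ + (m ∸ q)) (∣∁p∣≡n∸∣p∣ S) ⟨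
      ∣ S ∣ + (∣ ∁ S ∣ ∸ q)                                     ≡⟨ cong (λ m → ∣ S ∣ + (∣ ∁ S ∣ ∸ m)) ∣T∣≡q ⟨
      ∣ S ∣ + (∣ ∁ S ∣ ∸ ∣ T ∣)                                 ≡⟨ cong (∣ S ∣ +_) (#between-suc≡ T⊆∁S) ⟨
      ∣ S ∣ + #between T (∁ S) (suc ∣ T ∣)                      ≡⟨ cong (λ m → ∣ S ∣ + #between T (∁ S) (suc m)) ∣T∣≡q ⟩
      ∣ S ∣ + #between T (∁ S) (suc q)                          ∎)
      where
      open ≡-Reasoning
      ∣S∣≤n = ≤-trans (m≤n+m ∣ S ∣ q) q+∣S∣≤n
      q≤n∸∣S∣ = ≤-trans (≤-reflexive (sym (m+n∸n≡m q ∣ S ∣))) (∸-monoˡ-≤ ∣ S ∣ q+∣S∣≤n)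

    #avoiding≡ : (∑[ T ∈ allSubsets n ] ⟦ ∣ T ∣ ≡ᵇ q ⟧ * 𝟙 (T ⊆? ∁ S)) ≡ (n ∸ ∣ S ∣) C q
    #avoiding≡ = trans (#subsets≡ (∁ S) q) (cong (_C q) (∣∁p∣≡n∸∣p∣ S))

    #meeting≡ : (∑[ T ∈ allSubsets n ] ⟦ ∣ T ∣ ≡ᵇ q ⟧ * ⟦ not (does (T ⊆? ∁ S)) ⟧) ≡ n C q ∸ (n ∸ ∣ S ∣) C q
    #meeting≡ = begin
      #meeting                                   ≡⟨ m+n∸n≡m #meeting #avoiding ⟨
      #meeting + #avoiding ∸ #avoiding           ≡⟨ cong₂ _∸_ total #avoiding≡ ⟩
      n C q ∸ (n ∸ ∣ S ∣) C q                    ∎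
      where
      open ≡-Reasoning
      #meeting = ∑[ T ∈ allSubsets n ] ⟦ ∣ T ∣ ≡ᵇ q ⟧ * ⟦ not (does (T ⊆? ∁ S)) ⟧
      #avoiding = ∑[ T ∈ allSubsets n ] ⟦ ∣ T ∣ ≡ᵇ q ⟧ * 𝟙 (T ⊆? ∁ S)
      either : ∀ T → ⟦ ∣ T ∣ ≡ᵇ q ⟧ * ⟦ not (does (T ⊆? ∁ S)) ⟧ + ⟦ ∣ T ∣ ≡ᵇ q ⟧ * 𝟙 (T ⊆? ∁ S)
                     ≡ ⟦ ∣ T ∣ ≡ᵇ q ⟧ * 𝟙 (T ⊆? ⊤)
      either T = begin
        ⟦ ∣ T ∣ ≡ᵇ q ⟧ * ⟦ not (does (T ⊆? ∁ S)) ⟧ + ⟦ ∣ T ∣ ≡ᵇ q ⟧ * 𝟙 (T ⊆? ∁ S)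
          ≡⟨ *-distribˡ-+ ⟦ ∣ T ∣ ≡ᵇ q ⟧ _ _ ⟨
        ⟦ ∣ T ∣ ≡ᵇ q ⟧ * (⟦ not (does (T ⊆? ∁ S)) ⟧ + 𝟙 (T ⊆? ∁ S))
          ≡⟨ cong (⟦ ∣ T ∣ ≡ᵇ q ⟧ *_) (trans (⟦not⟧+⟦⟧ (does (T ⊆? ∁ S))) (sym (𝟙-yes (T ⊆? ⊤) ⊆⊤))) ⟩
        ⟦ ∣ T ∣ ≡ᵇ q ⟧ * 𝟙 (T ⊆? ⊤)
          ∎
      total : #meeting + #avoiding ≡ n C q
      total = trans (sym (∑-+ (allSubsets n) _ _))
                (trans (∑-cong (allSubsets n) either) (trans (#subsets≡ (⊤ {n}) q) (cong (_C q) (∣⊤∣≡n n))))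

    ∑-meeting-avoiding : ∀ x y →
      (∑[ T ∈ allSubsets n ] x * (⟦ ∣ T ∣ ≡ᵇ q ⟧ * ⟦ not (does (T ⊆? ∁ S)) ⟧) + y * (⟦ ∣ T ∣ ≡ᵇ q ⟧ * 𝟙 (T ⊆? ∁ S)))
        ≡ x * (n C q ∸ (n ∸ ∣ S ∣) C q) + y * ((n ∸ ∣ S ∣) C q)
    ∑-meeting-avoiding x y = trans (∑-+ (allSubsets n) _ _)
      (cong₂ _+_ (trans (∑-*ˡ (allSubsets n) x _) (cong (x *_) #meeting≡))
                 (trans (∑-*ˡ (allSubsets n) y _) (cong (y *_) #avoiding≡)))

    starSum-hitting : ∀ k → q + ∣ S ∣ ≤ n → starSum k q (hitting (suc q) S) ≡ hittingValue n q k ∣ S ∣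
    starSum-hitting k q+∣S∣≤n =
      trans (∑-cong (allSubsets n) by-kind) (∑-meeting-avoiding ((n ∸ q) C k) (∣ S ∣ C k))
      where
      arith₀ : ∀ x y → 0 ≡ x * 0 + y * 0
      arith₀ = solve-∀
      arith₁ : ∀ x y → 1 * x ≡ x * (1 * 1) + y * (1 * 0)
      arith₁ = solve-∀
      arith₂ : ∀ x y → 1 * y ≡ x * (1 * 0) + y * (1 * 1)
      arith₂ = solve-∀
      by-kind : ∀ T → ⟦ ∣ T ∣ ≡ᵇ q ⟧ * (degree (hitting (suc q) S) T C k)
        ≡ ((n ∸ q) C k) * (⟦ ∣ T ∣ ≡ᵇ q ⟧ * ⟦ not (does (T ⊆? ∁ S)) ⟧) + (∣ S ∣ C k) * (⟦ ∣ T ∣ ≡ᵇ q ⟧ * 𝟙 (T ⊆? ∁ S))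
      by-kind T with ∣ T ∣ ≡ᵇ q in ∣T∣≡ᵇq | T ⊆? ∁ S
      ... | false | _ = arith₀ ((n ∸ q) C k) (∣ S ∣ C k)
      ... | true  | no  T⊈∁S rewrite degree-hitting-meeting T⊈∁S (≡ᵇ-true⇒≡ ∣T∣≡ᵇq) =
        arith₁ ((n ∸ q) C k) (∣ S ∣ C k)
      ... | true  | yes T⊆∁S rewrite degree-hitting-avoiding T⊆∁S (≡ᵇ-true⇒≡ ∣T∣≡ᵇq) q+∣S∣≤n =
        arith₂ ((n ∸ q) C k) (∣ S ∣ C k)

allSubsets-complete : ∀ {n} (e : Subset n) → e ∈ˡ allSubsets n
allSubsets-complete []            = here refl
allSubsets-complete (inside ∷ e)  = ∈-++⁺ˡ (∈-map⁺ (inside ∷_) (allSubsets-complete e))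
allSubsets-complete (outside ∷ e) = ∈-++⁺ʳ _ (∈-map⁺ (outside ∷_) (allSubsets-complete e))

∑-allFin-suc : ∀ {n} (f : Fin (suc n) → ℕ) → ∑ (allFin (suc n)) f ≡ f zero + (∑[ i ∈ allFin n ] f (suc i))
∑-allFin-suc {n} f = cong (f zero +_) (trans (cong (λ vs → ∑ vs f) (sym (map-tabulate (λ i → i) suc)))
                                             (∑-map suc (allFin n) f))

∑-∈≡∣∣ : ∀ {n} (Y : Subset n) → (∑[ y ∈ allFin n ] 𝟙 (y ∈? Y)) ≡ ∣ Y ∣
∑-∈≡∣∣ []            = refl
∑-∈≡∣∣ (inside ∷ Y)  = trans (∑-allFin-suc (λ y → 𝟙 (y ∈? inside ∷ Y))) (cong suc (∑-∈≡∣∣ Y))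
∑-∈≡∣∣ (outside ∷ Y) = trans (∑-allFin-suc (λ y → 𝟙 (y ∈? outside ∷ Y))) (∑-∈≡∣∣ Y)

meets≤∑ : ∀ {n} (e Y : Subset n) → ⟦ meets e Y ⟧ ≤ (∑[ y ∈ allFin n ] 𝟙 (y ∈? Y) * 𝟙 (y ∈? e))
meets≤∑ []      []      = z≤n
meets≤∑ (a ∷ e) (b ∷ Y) =
  subst (⟦ meets (a ∷ e) (b ∷ Y) ⟧ ≤_) (sym (∑-allFin-suc (λ y → 𝟙 (y ∈? b ∷ Y) * 𝟙 (y ∈? a ∷ e)))) (at-head a b)
  where
  rest = ∑[ y ∈ allFin _ ] 𝟙 (y ∈? Y) * 𝟙 (y ∈? e)
  at-head : ∀ a b → ⟦ (a ∧ b) ∨ meets e Y ⟧ ≤ 𝟙 (zero ∈? b ∷ Y) * 𝟙 (zero ∈? a ∷ e) + rest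
  at-head inside  inside  = m≤m+n 1 rest
  at-head inside  outside = meets≤∑ e Y
  at-head outside inside  = meets≤∑ e Y
  at-head outside outside = meets≤∑ e Y

∑-meets≤ : ∀ {n} (w : Subset n → ℕ) (Y : Subset n) b →
  (∀ {y} → y ∈ Y → (∑[ e ∈ allSubsets n ] w e * 𝟙 (y ∈? e)) ≤ b) →
  (∑[ e ∈ allSubsets n ] w e * ⟦ meets e Y ⟧) ≤ ∣ Y ∣ * b
∑-meets≤ {n} w Y b bound = begin
  (∑[ e ∈ 𝒫 ] w e * ⟦ meets e Y ⟧)
    ≤⟨ ∑-mono-≤ 𝒫 (λ e → *-monoʳ-≤ (w e) (meets≤∑ e Y)) ⟩
  (∑[ e ∈ 𝒫 ] w e * (∑[ y ∈ 𝒱 ] 𝟙 (y ∈? Y) * 𝟙 (y ∈? e)))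
    ≡⟨ ∑-cong 𝒫 (λ e → trans (sym (∑-*ˡ 𝒱 (w e) _)) (∑-cong 𝒱 (λ y → x*[y*z]≡y*[x*z] (w e) (𝟙 (y ∈? Y)) _))) ⟩
  (∑[ e ∈ 𝒫 ] ∑[ y ∈ 𝒱 ] 𝟙 (y ∈? Y) * (w e * 𝟙 (y ∈? e)))
    ≡⟨ ∑-swap 𝒫 𝒱 _ ⟩
  (∑[ y ∈ 𝒱 ] ∑[ e ∈ 𝒫 ] 𝟙 (y ∈? Y) * (w e * 𝟙 (y ∈? e)))
    ≡⟨ ∑-cong 𝒱 (λ y → ∑-*ˡ 𝒫 (𝟙 (y ∈? Y)) _) ⟩
  (∑[ y ∈ 𝒱 ] 𝟙 (y ∈? Y) * (∑[ e ∈ 𝒫 ] w e * 𝟙 (y ∈? e)))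
    ≤⟨ ∑-mono-≤ 𝒱 bounded ⟩
  (∑[ y ∈ 𝒱 ] 𝟙 (y ∈? Y) * b)
    ≡⟨ ∑-*ʳ 𝒱 b (λ y → 𝟙 (y ∈? Y)) ⟩
  (∑[ y ∈ 𝒱 ] 𝟙 (y ∈? Y)) * b
    ≡⟨ cong (_* b) (∑-∈≡∣∣ Y) ⟩
  ∣ Y ∣ * b
    ∎
  where
  open ≤-Reasoning
  𝒫 = allSubsets n
  𝒱 = allFin n
  x*[y*z]≡y*[x*z] : ∀ x y z → x * (y * z) ≡ y * (x * z)
  x*[y*z]≡y*[x*z] = solve-∀
  bounded : ∀ y → 𝟙 (y ∈? Y) * (∑[ e ∈ 𝒫 ] w e * 𝟙 (y ∈? e)) ≤ 𝟙 (y ∈? Y) * b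
  bounded y with y ∈? Y
  ... | yes y∈Y = *-monoʳ-≤ 1 (bound y∈Y)
  ... | no  _   = z≤n

∣∪∣≤ : ∀ {n} (a b : Subset n) → ∣ a ∪ b ∣ ≤ ∣ a ∣ + ∣ b ∣
∣∪∣≤ []            []            = z≤n
∣∪∣≤ (inside  ∷ a) (inside  ∷ b) = s≤s (≤-trans (∣∪∣≤ a b) (+-monoʳ-≤ ∣ a ∣ (n≤1+n ∣ b ∣)))
∣∪∣≤ (inside  ∷ a) (outside ∷ b) = s≤s (∣∪∣≤ a b)
∣∪∣≤ (outside ∷ a) (inside  ∷ b) = ≤-trans (s≤s (∣∪∣≤ a b)) (≤-reflexive (sym (+-suc ∣ a ∣ ∣ b ∣)))
∣∪∣≤ (outside ∷ a) (outside ∷ b) = ∣∪∣≤ a b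

∣⋃∣≤ : ∀ {n} r (ps : List (Subset n)) → All (λ p → ∣ p ∣ ≡ r) ps → ∣ ⋃ ps ∣ ≤ r * length ps
∣⋃∣≤ {n} r []       []           = ≤-trans (≤-reflexive (∣⊥∣≡0 n)) z≤n
∣⋃∣≤     r (p ∷ ps) (∣p∣≡r ∷ ∣ps∣) = begin
  ∣ p ∪ ⋃ ps ∣               ≤⟨ ∣∪∣≤ p (⋃ ps) ⟩
  ∣ p ∣ + ∣ ⋃ ps ∣           ≤⟨ +-mono-≤ (≤-reflexive ∣p∣≡r) (∣⋃∣≤ r ps ∣ps∣) ⟩
  r + r * length ps          ≡⟨ *-suc r (length ps) ⟨
  r * suc (length ps)        ∎
  where open ≤-Reasoning

⋃-⊆ : ∀ {n} {Q : Subset n} (ps : List (Subset n)) → All (_⊆ Q) ps → ⋃ ps ⊆ Q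
⋃-⊆ []       []           x∈⊥   = ⊥-elim (∉⊥ x∈⊥)
⋃-⊆ (p ∷ ps) (p⊆Q ∷ ps⊆Q) x∈p∪ with x∈p∪q⁻ p (⋃ ps) x∈p∪
... | inj₁ x∈p  = p⊆Q x∈p
... | inj₂ x∈ps = ⋃-⊆ ps ps⊆Q x∈ps

meets-sym : ∀ {n} (a b : Subset n) → meets a b ≡ meets b a
meets-sym []      []      = refl
meets-sym (x ∷ a) (y ∷ b) = cong₂ _∨_ (∧-comm x y) (meets-sym a b)

meets-∪ʳ : ∀ {n} (e a b : Subset n) → meets e (a ∪ b) ≡ meets e a ∨ meets e b
meets-∪ʳ []            []            []            = refl
meets-∪ʳ (inside  ∷ e) (inside  ∷ a) (_       ∷ b) = refl
meets-∪ʳ (inside  ∷ e) (outside ∷ a) (inside  ∷ b) = sym (∨-zeroʳ _)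
meets-∪ʳ (inside  ∷ e) (outside ∷ a) (outside ∷ b) = meets-∪ʳ e a b
meets-∪ʳ (outside ∷ e) (_       ∷ a) (_       ∷ b) = meets-∪ʳ e a b

disjoint-∪⁻ : ∀ {n} (e a b : Subset n) → meets e (a ∪ b) ≡ false → meets e a ≡ false × meets e b ≡ false
disjoint-∪⁻ e a b e∩[a∪b]≡∅ = ∨-conicalˡ _ _ eq , ∨-conicalʳ _ _ eq
  where eq = trans (sym (meets-∪ʳ e a b)) e∩[a∪b]≡∅

disjoint-∉ : ∀ {n} {e Y : Subset n} {v} → meets e Y ≡ false → v ∈ Y → v ∉ e
disjoint-∉ {e = e} {Y} e∩Y≡∅ v∈Y v∈e = ¬meets⇒Empty e Y e∩Y≡∅ (_ , x∈p∩q⁺ (v∈e , v∈Y))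

vertexDegree : ∀ {n} → Hypergraph n → Fin n → ℕ
vertexDegree {n} H v = ∑[ e ∈ allSubsets n ] ⟦ H e ⟧ * 𝟙 (v ∈? e)

∣⁅x⁆∪⁅y⁆∣≡2 : ∀ {n} {x y : Fin n} → x ≢ y → ∣ ⁅ x ⁆ ∪ ⁅ y ⁆ ∣ ≡ 2
∣⁅x⁆∪⁅y⁆∣≡2 {x = zero}  {zero}  x≢y = contradiction refl x≢y
∣⁅x⁆∪⁅y⁆∣≡2 {suc n} {zero}  {suc y} _ = cong suc (trans (cong ∣_∣ (∪-identityˡ ⁅ y ⁆)) (∣⁅x⁆∣≡1 y))
∣⁅x⁆∪⁅y⁆∣≡2 {suc n} {suc x} {zero}  _ = cong suc (trans (cong ∣_∣ (∪-identityʳ ⁅ x ⁆)) (∣⁅x⁆∣≡1 x))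
∣⁅x⁆∪⁅y⁆∣≡2 {x = suc x} {suc y} x≢y = ∣⁅x⁆∪⁅y⁆∣≡2 (x≢y ∘ cong suc)

⁅x⁆∪⁅y⁆⊆ : ∀ {n} {x y : Fin n} {e} → x ∈ e → y ∈ e → ⁅ x ⁆ ∪ ⁅ y ⁆ ⊆ e
⁅x⁆∪⁅y⁆⊆ {x = x} {y} {e} x∈e y∈e i∈ with x∈p∪q⁻ ⁅ x ⁆ ⁅ y ⁆ i∈
... | inj₁ i∈⁅x⁆ = subst (_∈ e) (sym (x∈⁅y⁆⇒x≡y x i∈⁅x⁆)) x∈e
... | inj₂ i∈⁅y⁆ = subst (_∈ e) (sym (x∈⁅y⁆⇒x≡y y i∈⁅y⁆)) y∈e

record Matching {n} (H : Hypergraph n) (X : Subset n) : Set where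
  field
    members  : List (Subset n)
    inH      : All (λ e → H e ≡ true) members
    avoid    : All (λ e → meets e X ≡ false) members
    disjoint : AllPairs (λ a b → meets a b ≡ false) members

AllPairs-lookup : ∀ {A : Set} {R : A → A → Set} → (∀ {a b} → R a b → R b a) → ∀ {xs} → AllPairs R xs →
  ∀ i j → i ≢ j → R (List.lookup xs i) (List.lookup xs j)
AllPairs-lookup R-sym (Rx ∷ _)   zero    zero    i≢j = contradiction refl i≢j
AllPairs-lookup R-sym (Rx ∷ _)   zero    (suc j) _   = All.lookup Rx (∈-lookup j)
AllPairs-lookup R-sym (Rx ∷ _)   (suc i) zero    _   = R-sym (All.lookup Rx (∈-lookup i))
AllPairs-lookup R-sym (_  ∷ Rxs) (suc i) (suc j) i≢j = AllPairs-lookup R-sym Rxs i j (i≢j ∘ cong suc)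

Matching⇒HasMatching : ∀ {n} {H : Hypergraph n} {X} (M : Matching H X) → HasMatching H (length (Matching.members M))
Matching⇒HasMatching M =
  List.lookup members , (λ i → All.lookup inH (∈-lookup i)) ,
  (λ i j i≢j → ¬meets⇒Empty _ _ (AllPairs-lookup (λ {a} {b} a∩b≡∅ → trans (meets-sym b a) a∩b≡∅) disjoint i j i≢j))
  where open Matching M

vertexSet : ∀ {n} → List (Fin n) → Subset n
vertexSet vs = ⋃ (map ⁅_⁆ vs)

∣vertexSet∣≤ : ∀ {n} (vs : List (Fin n)) → ∣ vertexSet vs ∣ ≤ length vs
∣vertexSet∣≤ vs = ≤-trans (∣⋃∣≤ 1 (map ⁅_⁆ vs) (All.map⁺ (All.universal ∣⁅x⁆∣≡1 vs)))
                          (≤-reflexive (trans (*-identityˡ _) (length-map ⁅_⁆ vs)))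

∈-vertexSet : ∀ {n} (vs : List (Fin n)) → All (_∈ vertexSet vs) vs
∈-vertexSet []       = []
∈-vertexSet (v ∷ vs) = x∈p∪q⁺ (inj₁ (x∈⁅x⁆ v)) ∷ All.map (λ w∈ → x∈p∪q⁺ (inj₂ w∈)) (∈-vertexSet vs)

∉-vertexSet : ∀ {n} {v : Fin n} {vs} → All (v ≢_) vs → v ∉ vertexSet vs
∉-vertexSet {vs = []}     []           v∈⊥ = ∉⊥ v∈⊥
∉-vertexSet {vs = w ∷ vs} (v≢w ∷ v∉vs) v∈ with x∈p∪q⁻ ⁅ w ⁆ (vertexSet vs) v∈
... | inj₁ v∈⁅w⁆ = v≢w (x∈⁅y⁆⇒x≡y w v∈⁅w⁆)
... | inj₂ v∈vs  = ∉-vertexSet v∉vs v∈vs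

module Degrees {n : ℕ} (p : ℕ) (H : Hypergraph n) (uniform : Uniform (2 + p) H) where

  codegree≤ : ∀ {v y} → v ≢ y → (∑[ e ∈ allSubsets n ] ⟦ H e ⟧ * 𝟙 (v ∈? e) * 𝟙 (y ∈? e)) ≤ (n ∸ 2) C p
  codegree≤ {v} {y} v≢y = begin
    (∑[ e ∈ allSubsets n ] ⟦ H e ⟧ * 𝟙 (v ∈? e) * 𝟙 (y ∈? e))  ≤⟨ ∑-mono-≤ (allSubsets n) through-both ⟩
    #between P ⊤ (2 + p)                                       ≡⟨ cong (λ m → #between P ⊤ (m + p)) ∣P∣≡2 ⟨
    #between P ⊤ (∣ P ∣ + p)                                   ≡⟨ #between-≡ {P = P} {⊤} ⊆⊤ p ⟩
    (∣ ⊤ {n} ∣ ∸ ∣ P ∣) C p                                    ≡⟨ cong₂ (λ a b → (a ∸ b) C p) (∣⊤∣≡n n) ∣P∣≡2 ⟩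
    (n ∸ 2) C p                                                ∎
    where
    open ≤-Reasoning
    P = ⁅ v ⁆ ∪ ⁅ y ⁆
    ∣P∣≡2 = ∣⁅x⁆∪⁅y⁆∣≡2 v≢y
    through-both : ∀ e → ⟦ H e ⟧ * 𝟙 (v ∈? e) * 𝟙 (y ∈? e) ≤ isBetween P ⊤ (2 + p) e
    through-both e with H e in He | v ∈? e | y ∈? e
    ... | false | _       | _       = z≤n
    ... | true  | no _    | _       = z≤n
    ... | true  | yes _   | no _    = z≤n
    ... | true  | yes v∈e | yes y∈e
      rewrite uniform e He | 𝟙-yes (P ⊆? e) (⁅x⁆∪⁅y⁆⊆ v∈e y∈e) | 𝟙-yes (e ⊆? ⊤) ⊆⊤ | 𝟙-yes (p ≟ p) refl = ≤-refl

  edge-avoiding : ∀ {v Y} c → v ∉ Y → ∣ Y ∣ ≤ c → c * ((n ∸ 2) C p) < vertexDegree H v →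
    ∃[ e ] (H e ≡ true × meets e Y ≡ false)
  edge-avoiding {v} {Y} c v∉Y ∣Y∣≤c c*B<deg =
    witness (∑-positive (allSubsets n) (λ e → through-v e * ⟦ not (meets e Y) ⟧) avoiding>0)
    where
    B = (n ∸ 2) C p
    through-v : Subset n → ℕ
    through-v e = ⟦ H e ⟧ * 𝟙 (v ∈? e)
    Meeting = ∑[ e ∈ allSubsets n ] through-v e * ⟦ meets e Y ⟧
    Avoiding = ∑[ e ∈ allSubsets n ] through-v e * ⟦ not (meets e Y) ⟧
    meeting≤ : Meeting ≤ c * B
    meeting≤ = ≤-trans (∑-meets≤ through-v Y B (λ {y} y∈Y → codegree≤ {v} {y} (λ { refl → v∉Y y∈Y })))
                       (*-monoˡ-≤ B ∣Y∣≤c)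
    x≡x*1+x*0 : ∀ x → x ≡ x * 1 + x * 0
    x≡x*1+x*0 = solve-∀
    x≡x*0+x*1 : ∀ x → x ≡ x * 0 + x * 1
    x≡x*0+x*1 = solve-∀
    by-meets : ∀ x b → x ≡ x * ⟦ b ⟧ + x * ⟦ not b ⟧
    by-meets x true  = x≡x*1+x*0 x
    by-meets x false = x≡x*0+x*1 x
    split : vertexDegree H v ≡ Meeting + Avoiding
    split = trans (∑-cong (allSubsets n) (λ e → by-meets (through-v e) (meets e Y))) (∑-+ (allSubsets n) _ _)
    avoiding>0 : 0 < Avoiding
    avoiding>0 = +-cancelˡ-< (c * B) 0 Avoiding (begin-strict
      c * B + 0              ≡⟨ +-identityʳ (c * B) ⟩
      c * B                  <⟨ c*B<deg ⟩
      vertexDegree H v       ≡⟨ split ⟩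
      Meeting + Avoiding     ≤⟨ +-monoˡ-≤ Avoiding meeting≤ ⟩
      c * B + Avoiding       ∎)
      where open ≤-Reasoning
    witness : ∃[ e ] 0 < through-v e * ⟦ not (meets e Y) ⟧ → ∃[ e ] (H e ≡ true × meets e Y ≡ false)
    witness (e , pos) with H e in He | v ∈? e | meets e Y in e∩Y
    ... | true  | yes _ | false = e , He , e∩Y
    ... | true  | yes _ | true  = contradiction pos (<-irrefl refl)
    ... | true  | no _  | _     = contradiction pos (<-irrefl refl)
    ... | false | _     | _     = contradiction pos (<-irrefl refl)

  greedy : ∀ c (X : Subset n) (vs : List (Fin n)) → Unique vs → All (λ v → c * ((n ∸ 2) C p) < vertexDegree H v) vs →
    All (_∉ X) vs → ∣ X ∣ + (3 + p) * length vs ≤ c → ∃[ M ] length (Matching.members {H = H} {X} M) ≡ length vs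
  greedy c X []       _            _            _            _    =
    record { members = [] ; inH = [] ; avoid = [] ; disjoint = [] } , refl
  greedy c X (v ∷ vs) (v∉vs ∷ vs!) (deg-v ∷ degs) (v∉X ∷ vs∉X) size
    with edge-avoiding {v} {X ∪ vertexSet vs} c v∉Y ∣Y∣≤c deg-v
    where
    v∉Y : v ∉ X ∪ vertexSet vs
    v∉Y v∈ with x∈p∪q⁻ X (vertexSet vs) v∈
    ... | inj₁ v∈X  = v∉X v∈X
    ... | inj₂ v∈vs = ∉-vertexSet v∉vs v∈vs
    ∣Y∣≤c : ∣ X ∪ vertexSet vs ∣ ≤ c
    ∣Y∣≤c = begin
      ∣ X ∪ vertexSet vs ∣                  ≤⟨ ∣∪∣≤ X (vertexSet vs) ⟩
      ∣ X ∣ + ∣ vertexSet vs ∣              ≤⟨ +-monoʳ-≤ ∣ X ∣ (∣vertexSet∣≤ vs) ⟩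
      ∣ X ∣ + length vs                     ≤⟨ +-monoʳ-≤ ∣ X ∣ (≤-trans (n≤1+n _) (m≤n*m (suc (length vs)) (3 + p))) ⟩
      ∣ X ∣ + (3 + p) * suc (length vs)     ≤⟨ size ⟩
      c                                     ∎
      where open ≤-Reasoning
  ... | e , He , e∩Y≡∅ = record
    { members  = e ∷ members
    ; inH      = He ∷ inH
    ; avoid    = e∩X≡∅ ∷ All.map (λ {a} a∩[X∪e]≡∅ → proj₁ (disjoint-∪⁻ a X e a∩[X∪e]≡∅)) avoid
    ; disjoint = All.map (λ {a} a∩[X∪e]≡∅ → trans (meets-sym e a) (proj₂ (disjoint-∪⁻ a X e a∩[X∪e]≡∅))) avoid ∷ disjoint
    } , cong suc (proj₂ rest)
    where
    e∩X≡∅ = proj₁ (disjoint-∪⁻ e X (vertexSet vs) e∩Y≡∅)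
    e∩vs≡∅ = proj₂ (disjoint-∪⁻ e X (vertexSet vs) e∩Y≡∅)
    vs∉X∪e : All (_∉ X ∪ e) vs
    vs∉X∪e = All.zipWith (λ (w∉X , w∈vs) w∈X∪e → [ w∉X , disjoint-∉ e∩vs≡∅ w∈vs ]′ (x∈p∪q⁻ X e w∈X∪e))
                         (vs∉X , ∈-vertexSet vs)
    size′ : ∣ X ∪ e ∣ + (3 + p) * length vs ≤ c
    size′ = begin
      ∣ X ∪ e ∣ + (3 + p) * length vs           ≤⟨ +-monoˡ-≤ _ (∣∪∣≤ X e) ⟩
      ∣ X ∣ + ∣ e ∣ + (3 + p) * length vs       ≡⟨ cong (λ m → ∣ X ∣ + m + (3 + p) * length vs) (uniform e He) ⟩
      ∣ X ∣ + (2 + p) + (3 + p) * length vs     ≤⟨ ≤-trans (n≤1+n _) (≤-reflexive (rearrange ∣ X ∣ p (length vs))) ⟩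
      ∣ X ∣ + (3 + p) * suc (length vs)         ≤⟨ size ⟩
      c                                         ∎
      where
      open ≤-Reasoning
      rearrange : ∀ x p l → suc (x + (2 + p) + (3 + p) * l) ≡ x + (3 + p) * suc l
      rearrange = solve-∀
    rest = greedy c (X ∪ e) vs vs! degs vs∉X∪e size′
    open Matching (proj₁ rest)

meets-⊥ : ∀ {n} (a : Subset n) → meets a ⊥ ≡ false
meets-⊥ []            = refl
meets-⊥ (inside  ∷ a) = meets-⊥ a
meets-⊥ (outside ∷ a) = meets-⊥ a

meets-∪-mono : ∀ {n} (e a b : Subset n) → meets e b ≡ true → meets e (a ∪ b) ≡ true
meets-∪-mono e a b e∩b≢∅ = trans (meets-∪ʳ e a b) (trans (cong (meets e a ∨_) e∩b≢∅) (∨-zeroʳ (meets e a)))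

disjoint-⋃⁻ : ∀ {n} (e : Subset n) R → meets e (⋃ R) ≡ false → All (λ a → meets e a ≡ false) R
disjoint-⋃⁻ e []      _ = []
disjoint-⋃⁻ e (a ∷ R) e∩⋃≡∅ = proj₁ split ∷ disjoint-⋃⁻ e R (proj₂ split)
  where split = disjoint-∪⁻ e a (⋃ R) e∩⋃≡∅

∣∣>0⇒Nonempty : ∀ {n} {p : Subset n} → 0 < ∣ p ∣ → Nonempty p
∣∣>0⇒Nonempty {p = inside  ∷ p} _   = zero , here
∣∣>0⇒Nonempty {p = outside ∷ p} pos with ∣∣>0⇒Nonempty {p = p} pos
... | x , x∈p = suc x , there x∈p

module _ {n : ℕ} (F : Subset n → Bool) where

  addIfDisjoint : Subset n → List (Subset n) → List (Subset n)
  addIfDisjoint e R = if F e ∧ not (meets e (⋃ R)) then e ∷ R else R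

  maximalMatching : List (Subset n) → List (Subset n)
  maximalMatching = foldr addIfDisjoint []

  maximalMatching-sound : ∀ es → All (λ e → F e ≡ true) (maximalMatching es)
                               × AllPairs (λ a b → meets a b ≡ false) (maximalMatching es)
  maximalMatching-sound []       = [] , []
  maximalMatching-sound (e ∷ es) with F e ∧ not (meets e (⋃ (maximalMatching es))) in added
  ... | true  = ∧-conicalˡ _ _ added ∷ proj₁ (maximalMatching-sound es)
              , disjoint-⋃⁻ e _ (not-injective (∧-conicalʳ _ _ added)) ∷ proj₂ (maximalMatching-sound es)
  ... | false = maximalMatching-sound es

  maximalMatching-maximal : (∀ {e} → F e ≡ true → Nonempty e) →
    ∀ es → All (λ e → F e ≡ true → meets e (⋃ (maximalMatching es)) ≡ true) es
  maximalMatching-maximal nonempty []       = []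
  maximalMatching-maximal nonempty (e ∷ es) with F e ∧ not (meets e (⋃ (maximalMatching es))) in added
  ... | true  = (λ Fe → meets-self Fe) ∷ All.map (λ covered Fe′ → meets-∪-mono _ e _ (covered Fe′))
                                                  (maximalMatching-maximal nonempty es)
    where
    meets-self : F e ≡ true → meets e (e ∪ ⋃ (maximalMatching es)) ≡ true
    meets-self Fe with nonempty Fe
    ... | x , x∈e = Nonempty⇒meets e _ (x , x∈p∩q⁺ (x∈e , x∈p∪q⁺ (inj₁ x∈e)))
  ... | false = blocked ∷ maximalMatching-maximal nonempty es
    where
    blocked : F e ≡ true → meets e (⋃ (maximalMatching es)) ≡ true
    blocked Fe with meets e (⋃ (maximalMatching es))
    ... | true  = refl
    ... | false = contradiction (trans (sym added) (cong (_∧ true) Fe)) (λ ())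

module HighDegree {n : ℕ} (p : ℕ) (H : Hypergraph n) (uniform : Uniform (2 + p) H)
                  (s : ℕ) (ν<s : MatchingNumberLt H s) where

  open Degrees p H uniform

  B : ℕ
  B = (n ∸ 2) C p

  -- Large enough for both greedy matchings below: (r + 1)s vertices for s edges from scratch,
  -- r + (r + 1)(s − 1) for s − 1 edges avoiding a given edge.
  c : ℕ
  c = (2 + p) + (3 + p) * s

  A : Subset n
  A = tabulate (λ v → does (c * B <? vertexDegree H v))

  ∈A⇒ : ∀ {v} → v ∈ A → c * B < vertexDegree H v
  ∈A⇒ {v} v∈A = does⇒ (c * B <? vertexDegree H v) (trans (sym (lookup∘tabulate _ v)) ([]=⇒lookup v∈A))

  ∉A⇒ : ∀ {v} → v ∉ A → vertexDegree H v ≤ c * B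
  ∉A⇒ {v} v∉A = ≮⇒≥ (λ c*B<deg →
    v∉A (lookup⇒[]= v A (trans (lookup∘tabulate _ v) (dec-true (c * B <? vertexDegree H v) c*B<deg))))

  high : List (Fin n)
  high = filter (_∈? A) (allFin n)

  length-high : length high ≡ ∣ A ∣
  length-high = trans (length-filter (_∈? A) (allFin n)) (∑-∈≡∣∣ A)

  high-Unique : Unique high
  high-Unique = Unique.filter⁺ (_∈? A) (Unique.allFin⁺ n)

  high-∈A : All (_∈ A) high
  high-∈A = All.all-filter (_∈? A) (allFin n)

  no-large-matching : ∀ {X} (M : Matching H X) → length (Matching.members M) < s
  no-large-matching M = ≰⇒> (λ s≤ → ν<s _ s≤ (Matching⇒HasMatching M))

  ∣A∣<s : ∣ A ∣ < s
  ∣A∣<s = ≰⇒> too-many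
    where
    too-many : ¬ (s ≤ ∣ A ∣)
    too-many s≤∣A∣ = <-irrefl length≡s (no-large-matching M)
      where
      ∣taken∣≡s : length (List.take s high) ≡ s
      ∣taken∣≡s = trans (length-take s high) (m≤n⇒m⊓n≡m (subst (s ≤_) (sym length-high) s≤∣A∣))
      size : ∣ ⊥ {n} ∣ + (3 + p) * length (List.take s high) ≤ c
      size = ≤-trans (≤-reflexive (cong₂ _+_ (∣⊥∣≡0 n) (cong ((3 + p) *_) ∣taken∣≡s))) (m≤n+m _ (2 + p))
      result = greedy c ⊥ (List.take s high) (AllPairs.take⁺ s high-Unique)
                      (All.take⁺ s (All.map ∈A⇒ high-∈A)) (All.universal (λ _ → ∉⊥) _) size
      M = proj₁ result
      length≡s : length (Matching.members M) ≡ s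
      length≡s = trans (proj₂ result) ∣taken∣≡s

  edges-meet-A : ∣ A ∣ ≡ s ∸ 1 → 1 ≤ s → ∀ e → H e ≡ true → meets e A ≡ true
  edges-meet-A ∣A∣≡s-1 1≤s e He with meets e A in e∩A
  ... | true  = refl
  ... | false = ⊥-elim (<-irrefl length≡s (no-large-matching M′))
    where
    size : ∣ e ∣ + (3 + p) * length high ≤ c
    size = ≤-trans (≤-reflexive (cong₂ (λ a b → a + (3 + p) * b) (uniform e He) (trans length-high ∣A∣≡s-1)))
                   (+-monoʳ-≤ (2 + p) (*-monoʳ-≤ (3 + p) (m∸n≤m s 1)))
    result = greedy c e high high-Unique (All.map ∈A⇒ high-∈A) (All.map (disjoint-∉ e∩A) high-∈A) size
    open Matching (proj₁ result)
    M′ : Matching H ⊥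
    M′ = record
      { members  = e ∷ members
      ; inH      = He ∷ inH
      ; avoid    = All.universal meets-⊥ _
      ; disjoint = All.map (λ {a} a∩e≡∅ → trans (meets-sym e a) a∩e≡∅) avoid ∷ disjoint
      }
    length≡s : length (e ∷ members) ≡ s
    length≡s = trans (cong suc (trans (proj₂ result) (trans length-high ∣A∣≡s-1))) (m+[n∸m]≡n 1≤s)

  edges-avoiding-A≤ : (∑[ e ∈ allSubsets n ] ⟦ H e ⟧ * 𝟙 (e ⊆? ∁ A)) ≤ (2 + p) * (s ∸ 1) * (c * B)
  edges-avoiding-A≤ = begin
    (∑[ e ∈ allSubsets n ] ⟦ H e ⟧ * 𝟙 (e ⊆? ∁ A))         ≤⟨ ∑-mono-≤ (allSubsets n) covered ⟩
    (∑[ e ∈ allSubsets n ] ⟦ H e ⟧ * ⟦ meets e (⋃ R) ⟧)    ≤⟨ ∑-meets≤ (λ e → ⟦ H e ⟧) (⋃ R) (c * B) low-degree ⟩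
    ∣ ⋃ R ∣ * (c * B)
      ≤⟨ *-monoˡ-≤ (c * B) (∣⋃∣≤ (2 + p) R (All.map (uniform _) R-inH)) ⟩
    (2 + p) * length R * (c * B)                            ≤⟨ *-monoˡ-≤ (c * B) (*-monoʳ-≤ (2 + p) (∸-monoˡ-≤ 1 ∣R∣<s)) ⟩
    (2 + p) * (s ∸ 1) * (c * B)                             ∎
    where
    open ≤-Reasoning
    avoidsA : Subset n → Bool
    avoidsA e = H e ∧ does (e ⊆? ∁ A)
    R = maximalMatching avoidsA (allSubsets n)
    sound = maximalMatching-sound avoidsA (allSubsets n)
    R-inH = All.map (λ {e} avoidsA-e → ∧-conicalˡ (H e) _ avoidsA-e) (proj₁ sound)
    avoidsA⇒⊆∁A : ∀ {e} → avoidsA e ≡ true → e ⊆ ∁ A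
    avoidsA⇒⊆∁A {e} avoidsA-e = does⇒ (e ⊆? ∁ A) (∧-conicalʳ (H e) _ avoidsA-e)
    R⊆∁A : All (_⊆ ∁ A) R
    R⊆∁A = All.map avoidsA⇒⊆∁A (proj₁ sound)
    ∣R∣<s : length R < s
    ∣R∣<s = no-large-matching {⊥}
      (record { members = R ; inH = R-inH ; avoid = All.universal meets-⊥ R ; disjoint = proj₂ sound })
    maximal = maximalMatching-maximal avoidsA
      (λ {e} avoidsA-e → ∣∣>0⇒Nonempty (subst (0 <_) (sym (uniform e (∧-conicalˡ (H e) _ avoidsA-e))) z<s)) (allSubsets n)
    covered : ∀ e → ⟦ H e ⟧ * 𝟙 (e ⊆? ∁ A) ≤ ⟦ H e ⟧ * ⟦ meets e (⋃ R) ⟧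
    covered e with H e in He | e ⊆? ∁ A
    ... | false | _         = z≤n
    ... | true  | no  _     = z≤n
    ... | true  | yes e⊆∁A
      rewrite All.lookup maximal (allSubsets-complete e) (cong₂ _∧_ He (dec-true (e ⊆? ∁ A) e⊆∁A)) = ≤-refl
    low-degree : ∀ {y} → y ∈ ⋃ R → vertexDegree H y ≤ c * B
    low-degree y∈⋃R = ∉A⇒ (x∈∁p⇒x∉p (⋃-⊆ R R⊆∁A y∈⋃R))

module UpperBound {n : ℕ} (q : ℕ) (H : Hypergraph n) (uniform : Uniform (suc q) H) (A : Subset n) where

  avoiding : Subset n → ℕ
  avoiding e = ⟦ H e ⟧ * 𝟙 (e ⊆? ∁ A)

  meeting : Subset n → ℕ
  meeting e = ⟦ H e ⟧ * ⟦ not (does (e ⊆? ∁ A)) ⟧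

  degreeVia : (Subset n → ℕ) → Subset n → ℕ
  degreeVia w T = ∑[ e ∈ allSubsets n ] w e * 𝟙 (T ⊆? e)

  degree-split : ∀ T → degree H T ≡ degreeVia meeting T + degreeVia avoiding T
  degree-split T = trans (∑-cong (allSubsets n) by-kind) (∑-+ (allSubsets n) _ _)
    where
    by-kind : ∀ e → ⟦ H e ⟧ * 𝟙 (T ⊆? e) ≡ meeting e * 𝟙 (T ⊆? e) + avoiding e * 𝟙 (T ⊆? e)
    by-kind e with H e | e ⊆? ∁ A | T ⊆? e
    ... | false | _     | _     = refl
    ... | true  | yes _ | no  _ = refl
    ... | true  | no  _ | no  _ = refl
    ... | true  | yes _ | yes _ = refl
    ... | true  | no  _ | yes _ = refl

  meeting-degree≤ : ∀ {T} → T ⊆ ∁ A → ∣ T ∣ ≡ q → q + ∣ A ∣ ≤ n → degreeVia meeting T ≤ ∣ A ∣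
  meeting-degree≤ {T} T⊆∁A ∣T∣≡q q+∣A∣≤n =
    ≤-trans (∑-mono-≤ (allSubsets n) in-hitting) (≤-reflexive (degree-hitting-avoiding q A T⊆∁A ∣T∣≡q q+∣A∣≤n))
    where
    in-hitting : ∀ e → meeting e * 𝟙 (T ⊆? e) ≤ ⟦ hitting (suc q) A e ⟧ * 𝟙 (T ⊆? e)
    in-hitting e rewrite meets≡not[⊆∁] e A with H e in He
    ... | false = z≤n
    ... | true rewrite uniform e He | ≡ᵇ-refl q = ≤-reflexive (cong (_* 𝟙 (T ⊆? e)) (+-identityʳ ⟦ not (does (e ⊆? ∁ A)) ⟧))

  #edgesAvoiding : ℕ
  #edgesAvoiding = ∑[ e ∈ allSubsets n ] avoiding e

  starSum≤ : ∀ k′ → q + ∣ A ∣ ≤ n →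
    starSum (suc k′) q H ≤ hittingValue n q (suc k′) ∣ A ∣ + (n C k′) * (suc q * #edgesAvoiding)
  starSum≤ k′ q+∣A∣≤n = begin
    starSum k q H
      ≤⟨ ∑-mono-≤ 𝒫 bound ⟩
    (∑[ T ∈ 𝒫 ] (x * (⟦ ∣ T ∣ ≡ᵇ q ⟧ * ⟦ not (does (T ⊆? ∁ A)) ⟧) + y * (⟦ ∣ T ∣ ≡ᵇ q ⟧ * 𝟙 (T ⊆? ∁ A)))
                + z * (⟦ ∣ T ∣ ≡ᵇ q ⟧ * degreeVia avoiding T))
      ≡⟨ ∑-+ 𝒫 _ _ ⟩
    (∑[ T ∈ 𝒫 ] x * (⟦ ∣ T ∣ ≡ᵇ q ⟧ * ⟦ not (does (T ⊆? ∁ A)) ⟧) + y * (⟦ ∣ T ∣ ≡ᵇ q ⟧ * 𝟙 (T ⊆? ∁ A)))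
      + (∑[ T ∈ 𝒫 ] z * (⟦ ∣ T ∣ ≡ᵇ q ⟧ * degreeVia avoiding T))
      ≡⟨ cong₂ _+_ (∑-meeting-avoiding q A x y)
                   (trans (∑-*ˡ 𝒫 z _) (cong (z *_) (double-counting-uniform q avoiding support))) ⟩
    hittingValue n q k ∣ A ∣ + z * (suc q * #edgesAvoiding)
      ∎
    where
    open ≤-Reasoning
    𝒫 = allSubsets n
    k = suc k′
    x = (n ∸ q) C k
    y = ∣ A ∣ C k
    z = n C k′
    support : ∀ e → 0 < avoiding e → ∣ e ∣ ≡ suc q
    support e pos with H e in He
    ... | true  = uniform e He
    ... | false = contradiction pos (λ ())
    bound : ∀ T → ⟦ ∣ T ∣ ≡ᵇ q ⟧ * (degree H T C k) ≤
      (x * (⟦ ∣ T ∣ ≡ᵇ q ⟧ * ⟦ not (does (T ⊆? ∁ A)) ⟧) + y * (⟦ ∣ T ∣ ≡ᵇ q ⟧ * 𝟙 (T ⊆? ∁ A)))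
        + z * (⟦ ∣ T ∣ ≡ᵇ q ⟧ * degreeVia avoiding T)
    bound T with ∣ T ∣ ≡ᵇ q in ∣T∣≡ᵇq | T ⊆? ∁ A
    ... | false | _ = z≤n
    ... | true  | no _ = begin
      1 * (degree H T C k)        ≡⟨ *-identityˡ _ ⟩
      degree H T C k              ≤⟨ C-monoˡ-≤ k (degree≤ q H uniform {T} (≡ᵇ-true⇒≡ ∣T∣≡ᵇq)) ⟩
      x                           ≤⟨ m≤m+n x _ ⟩
      x + (y * 0 + z * (1 * degreeVia avoiding T))  ≡⟨ arrange x y z (degreeVia avoiding T) ⟩
      x * (1 * 1) + y * (1 * 0) + z * (1 * degreeVia avoiding T)  ∎
      where
      arrange : ∀ x y z d → x + (y * 0 + z * (1 * d)) ≡ x * (1 * 1) + y * (1 * 0) + z * (1 * d)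
      arrange = solve-∀
    ... | true  | yes T⊆∁A = begin
      1 * (degree H T C k)                 ≡⟨ *-identityˡ _ ⟩
      degree H T C k                       ≡⟨ cong (_C k) (degree-split T) ⟩
      (dI + dO) C k                        ≤⟨ C-+-≤ dI dO k′ ⟩
      dI C k + dO * ((dI + dO) C k′)       ≤⟨ +-mono-≤ (C-monoˡ-≤ k (meeting-degree≤ {T} T⊆∁A ∣T∣≡q q+∣A∣≤n))
                                                       (*-monoʳ-≤ dO (C-monoˡ-≤ k′ dI+dO≤n)) ⟩
      y + dO * z                           ≡⟨ arrange x y z dO ⟩
      x * (1 * 0) + y * (1 * 1) + z * (1 * dO)  ∎
      where
      ∣T∣≡q = ≡ᵇ-true⇒≡ ∣T∣≡ᵇq
      dI = degreeVia meeting T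
      dO = degreeVia avoiding T
      dI+dO≤n : dI + dO ≤ n
      dI+dO≤n = ≤-trans (≤-reflexive (sym (degree-split T))) (≤-trans (degree≤ q H uniform {T} ∣T∣≡q) (m∸n≤m n q))
      arrange : ∀ x y z d → y + d * z ≡ x * (1 * 0) + y * (1 * 1) + z * (1 * d)
      arrange = solve-∀

C-gap : ∀ N k′ K c → 2 * k′ ≤ N → 2 * suc k′ * (K + c) < N → K * (N C k′) + c < N C suc k′
C-gap zero    k′ K c _     ()
C-gap (suc N) k′ K c 2k′≤N 2[1+k′][K+c]<N = *-cancelˡ-< (2 * suc k′) _ _ (begin-strict
  2 * suc k′ * (K * b + c)                    ≤⟨ *-monoʳ-≤ (2 * suc k′) (+-monoʳ-≤ (K * b) (m≤m*n c b)) ⟩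
  2 * suc k′ * (K * b + c * b)                ≡⟨ factor (2 * suc k′) K c b ⟩
  2 * suc k′ * (K + c) * b                    <⟨ *-monoˡ-< b 2[1+k′][K+c]<N ⟩
  suc N * b                                   ≤⟨ *-monoʳ-≤ (suc N) ([1+m]Cj≤2*mCj N k′ 2k′≤N) ⟩
  suc N * (2 * (N C k′))                      ≡⟨ x*[2*y]≡2*[x*y] (suc N) (N C k′) ⟩
  2 * (suc N * (N C k′))                      ≡⟨ cong (2 *_) (C-absorption N k′) ⟨
  2 * (suc k′ * (suc N C suc k′))             ≡⟨ *-assoc 2 (suc k′) _ ⟨
  2 * suc k′ * (suc N C suc k′)               ∎)
  where
  open ≤-Reasoning
  b = suc N C k′
  1≤b : 1 ≤ b
  1≤b = C>0 (≤-trans (m≤m+n k′ (k′ + 0)) 2k′≤N)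
  instance
    b≢0 : NonZero b
    b≢0 = >-nonZero 1≤b
  factor : ∀ m K c b → m * (K * b + c * b) ≡ m * (K + c) * b
  factor = solve-∀
  x*[2*y]≡2*[x*y] : ∀ x y → x * (2 * y) ≡ 2 * (x * y)
  x*[2*y]≡2*[x*y] = solve-∀

-- Read with b = C(n−q, k), t = C(n, q), cₐ = C(a, k), cₛ = C(σ, k) and α, β the numbers of
-- q-sets avoiding an a-set and a σ-set: the left side is hittingValue at a plus an error W,
-- the right side is hittingValue at σ.
exchange-< : ∀ b t α β X δ cₐ cₛ W → α ≡ β + X + δ → α ≤ t → cₐ ≤ cₛ → cₐ ≤ b → cₐ * X + W < b * X →
  b * (t ∸ α) + cₐ * α + W < b * (t ∸ β) + cₛ * β
exchange-< b t α β X δ cₐ cₛ W α≡ α≤t cₐ≤cₛ cₐ≤b gain = begin-strict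
  b * u + cₐ * α + W                            ≡⟨ cong (λ m → b * u + cₐ * m + W) α≡ ⟩
  b * u + cₐ * (β + X + δ) + W                  ≡⟨ regroup b u cₐ β X δ W ⟩
  b * u + (cₐ * β + cₐ * δ + (cₐ * X + W))
    <⟨ +-monoʳ-< (b * u) (+-mono-≤-< (+-mono-≤ (*-monoˡ-≤ β cₐ≤cₛ) (*-monoˡ-≤ δ cₐ≤b)) gain) ⟩
  b * u + (cₛ * β + b * δ + b * X)              ≡⟨ collect b u cₛ β X δ ⟩
  b * (u + (X + δ)) + cₛ * β                    ≡⟨ cong (λ m → b * m + cₛ * β) t∸β ⟨
  b * (t ∸ β) + cₛ * β                          ∎
  where
  open ≤-Reasoning
  u = t ∸ α
  regroup : ∀ b u cₐ β X δ W → b * u + cₐ * (β + X + δ) + W ≡ b * u + (cₐ * β + cₐ * δ + (cₐ * X + W))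
  regroup = solve-∀
  collect : ∀ b u cₛ β X δ → b * u + (cₛ * β + b * δ + b * X) ≡ b * (u + (X + δ)) + cₛ * β
  collect = solve-∀
  rotate : ∀ u β X δ → u + (β + X + δ) ≡ u + (X + δ) + β
  rotate = solve-∀
  t∸β : t ∸ β ≡ u + (X + δ)
  t∸β = begin-equality
    t ∸ β                        ≡⟨ cong (_∸ β) (m∸n+n≡m α≤t) ⟨
    u + α ∸ β                    ≡⟨ cong (λ m → u + m ∸ β) α≡ ⟩
    u + (β + X + δ) ∸ β          ≡⟨ cong (_∸ β) (rotate u β X δ) ⟩
    u + (X + δ) + β ∸ β          ≡⟨ m+n∸n≡m (u + (X + δ)) β ⟩
    u + (X + δ)                  ∎

module _ {n : ℕ} {H G : Hypergraph n} (H⊆G : ∀ e → H e ≡ true → G e ≡ true) where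

  edge-mono : ∀ T e → ⟦ H e ⟧ * 𝟙 (T ⊆? e) ≤ ⟦ G e ⟧ * 𝟙 (T ⊆? e)
  edge-mono T e with H e in He
  ... | false = z≤n
  ... | true rewrite H⊆G e He = ≤-refl

  degree-mono : ∀ T → degree H T ≤ degree G T
  degree-mono T = ∑-mono-≤ (allSubsets n) (edge-mono T)

  starSum-mono : ∀ k q → starSum k q H ≤ starSum k q G
  starSum-mono k q = ∑-mono-≤ (allSubsets n) (λ T → *-monoʳ-≤ ⟦ ∣ T ∣ ≡ᵇ q ⟧ (C-monoˡ-≤ k (degree-mono T)))

  starSum-mono-< : ∀ k q {e T} → G e ≡ true → H e ≡ false → T ⊆ e → ∣ T ∣ ≡ q → 1 ≤ k → k ≤ degree G T →
    starSum k q H < starSum k q G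
  starSum-mono-< k q {e} {T} Ge He T⊆e ∣T∣≡q 1≤k k≤deg =
    ∑-mono-< (λ T′ → *-monoʳ-≤ ⟦ ∣ T′ ∣ ≡ᵇ q ⟧ (C-monoˡ-≤ k (degree-mono T′))) (allSubsets-complete T) at-T
    where
    missing : ⟦ H e ⟧ * 𝟙 (T ⊆? e) < ⟦ G e ⟧ * 𝟙 (T ⊆? e)
    missing rewrite He | Ge | 𝟙-yes (T ⊆? e) T⊆e = s≤s z≤n
    at-T : ⟦ ∣ T ∣ ≡ᵇ q ⟧ * (degree H T C k) < ⟦ ∣ T ∣ ≡ᵇ q ⟧ * (degree G T C k)
    at-T rewrite 𝟙-yes (∣ T ∣ ≟ q) ∣T∣≡q =
      +-monoˡ-< 0 (C-monoˡ-< (∑-mono-< (edge-mono T) (allSubsets-complete e) missing) k≤deg 1≤k)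

∃-kernel-meeting : ∀ {n} p {e A : Subset n} → ∣ e ∣ ≡ 2 + p → meets e A ≡ true →
  ∃[ T ] (∣ T ∣ ≡ suc p × T ⊆ e × ¬ (T ⊆ ∁ A))
∃-kernel-meeting {n} p {e} {A} ∣e∣≡ e∩A≢∅ = extract (∑-positive 𝒫 _ 0<#meeting)
  where
  q = suc p
  𝒫 = allSubsets n
  #meeting = ∑[ T ∈ 𝒫 ] ⟦ ∣ T ∣ ≡ᵇ q ⟧ * (𝟙 (T ⊆? e) * ⟦ not (does (T ⊆? ∁ A)) ⟧)
  #avoiding = ∑[ T ∈ 𝒫 ] ⟦ ∣ T ∣ ≡ᵇ q ⟧ * 𝟙 (T ⊆? e ∩ ∁ A)
  by-kind : ∀ T → 𝟙 (T ⊆? e) ≡ 𝟙 (T ⊆? e) * ⟦ not (does (T ⊆? ∁ A)) ⟧ + 𝟙 (T ⊆? e ∩ ∁ A)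
  by-kind T with T ⊆? e | T ⊆? ∁ A | T ⊆? e ∩ ∁ A
  ... | yes _   | yes _    | yes _     = refl
  ... | yes T⊆e | yes T⊆∁A | no T⊈e∩∁A = ⊥-elim (T⊈e∩∁A (⊆-∩⁺ T⊆e T⊆∁A))
  ... | yes _   | no T⊈∁A  | yes T⊆e∩∁A = ⊥-elim (T⊈∁A (λ i∈T → p∩q⊆q e (∁ A) (T⊆e∩∁A i∈T)))
  ... | yes _   | no _     | no _      = refl
  ... | no T⊈e  | _        | yes T⊆e∩∁A = ⊥-elim (T⊈e (λ i∈T → p∩q⊆p e (∁ A) (T⊆e∩∁A i∈T)))
  ... | no _    | _        | no _      = refl
  total : #meeting + #avoiding ≡ suc q
  total = begin
    #meeting + #avoiding                               ≡⟨ ∑-+ 𝒫 _ _ ⟨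
    (∑[ T ∈ 𝒫 ] ⟦ ∣ T ∣ ≡ᵇ q ⟧ * (𝟙 (T ⊆? e) * ⟦ not (does (T ⊆? ∁ A)) ⟧) + ⟦ ∣ T ∣ ≡ᵇ q ⟧ * 𝟙 (T ⊆? e ∩ ∁ A))
      ≡⟨ ∑-cong 𝒫 (λ T → trans (sym (*-distribˡ-+ ⟦ ∣ T ∣ ≡ᵇ q ⟧ _ _)) (cong (⟦ ∣ T ∣ ≡ᵇ q ⟧ *_) (sym (by-kind T)))) ⟩
    (∑[ T ∈ 𝒫 ] ⟦ ∣ T ∣ ≡ᵇ q ⟧ * 𝟙 (T ⊆? e))            ≡⟨ #subsets≡ e q ⟩
    ∣ e ∣ C q                                          ≡⟨ cong (_C q) ∣e∣≡ ⟩
    suc q C q                                          ≡⟨ [1+n]Cn≡1+n q ⟩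
    suc q                                              ∎
    where open ≡-Reasoning
  ∣e∩∁A∣≤q : ∣ e ∩ ∁ A ∣ ≤ q
  ∣e∩∁A∣≤q with ∣ e ∩ ∁ A ∣ ≤? q
  ... | yes ≤q = ≤q
  ... | no  ≰q = contradiction (trans (sym e∩A≢∅) (trans (meets≡not[⊆∁] e A) (cong not (dec-true (e ⊆? ∁ A) e⊆∁A))))
                               (λ ())
    where
    e∩∁A≡e : e ∩ ∁ A ≡ e
    e∩∁A≡e = ⊆∧∣∣≡⇒≡ (p∩q⊆p e (∁ A)) (≤-antisym (∣p∩q∣≤∣p∣ e (∁ A)) (subst (_≤ ∣ e ∩ ∁ A ∣) (sym ∣e∣≡) (≰⇒> ≰q)))
    e⊆∁A : e ⊆ ∁ A
    e⊆∁A i∈e = p∩q⊆q e (∁ A) (subst (_ ∈_) (sym e∩∁A≡e) i∈e)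
  #avoiding≤1 : #avoiding ≤ 1
  #avoiding≤1 = ≤-trans (≤-reflexive (#subsets≡ (e ∩ ∁ A) q)) (C≤1 ∣e∩∁A∣≤q)
  0<#meeting : 0 < #meeting
  0<#meeting = +-cancelʳ-< 1 0 #meeting (begin-strict
    1                       <⟨ s≤s (s≤s z≤n) ⟩
    suc q                   ≡⟨ total ⟨
    #meeting + #avoiding    ≤⟨ +-monoʳ-≤ #meeting #avoiding≤1 ⟩
    #meeting + 1            ∎)
    where open ≤-Reasoning
  extract : ∃[ T ] 0 < ⟦ ∣ T ∣ ≡ᵇ q ⟧ * (𝟙 (T ⊆? e) * ⟦ not (does (T ⊆? ∁ A)) ⟧) →
    ∃[ T ] (∣ T ∣ ≡ q × T ⊆ e × ¬ (T ⊆ ∁ A))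
  extract (T , pos) with ∣ T ∣ ≡ᵇ q in ∣T∣≡ᵇq | T ⊆? e | T ⊆? ∁ A
  ... | true  | yes T⊆e | no T⊈∁A = T , ≡ᵇ-true⇒≡ ∣T∣≡ᵇq , T⊆e , T⊈∁A
  ... | true  | yes _   | yes _   = contradiction pos (λ ())
  ... | true  | no _    | _       = contradiction pos (λ ())
  ... | false | _       | _       = contradiction pos (λ ())

-- The constant K with W ≤ K · C(n−p−1, k−1) · C(n−s+1, p) for the error term W of
-- UpperBound.starSum≤ (see Stability.Loose.W≤).
largeness : ℕ → ℕ → ℕ
largeness p s = 2 ^ suc p * ((2 + p) * ((2 + p) * (s ∸ 1) * c)) * 2 ^ (s ∸ 1)
  where c = (2 + p) + (3 + p) * s

threshold : ℕ → ℕ → ℕ → ℕ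
threshold p k′ s = suc p + ((s ∸ 1) + (2 * p + (2 * k′ + (2 * suc k′ * (largeness p s + (s ∸ 1) C suc k′) + suc k′))))

q+σ≤threshold : ∀ p k′ s → suc p + (s ∸ 1) ≤ threshold p k′ s
q+σ≤threshold p k′ s = +-monoʳ-≤ (suc p) (m≤m+n (s ∸ 1) _)

module Stability {n : ℕ} (p k′ : ℕ) (H : Hypergraph n) (uniform : Uniform (2 + p) H)
                 (s : ℕ) (ν<s : MatchingNumberLt H s) (1≤s : 1 ≤ s) (large : threshold p k′ s < n) where

  open HighDegree p H uniform s ν<s

  q = suc p
  k = suc k′
  σ = s ∸ 1
  N = n ∸ q
  a = ∣ A ∣
  K = largeness p s

  private
    W₀ = 2 * k * (K + σ C k)
    Z = σ + (2 * p + (2 * k′ + (W₀ + k)))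
    Z<N : Z < N
    Z<N = ≤-trans (≤-reflexive (sym (m+n∸m≡n q (suc Z)))) (∸-monoˡ-≤ q (≤-trans (≤-reflexive (+-suc q Z)) large))
    inner≤Z : 2 * k′ + (W₀ + k) ≤ Z
    inner≤Z = ≤-trans (m≤n+m _ (2 * p)) (m≤n+m _ σ)

  q+σ≤n : q + σ ≤ n
  q+σ≤n = ≤-trans (q+σ≤threshold p k′ s) (<⇒≤ large)

  2p≤n∸σ : 2 * p ≤ n ∸ σ
  2p≤n∸σ = ≤-trans (≤-reflexive (sym (m+n∸m≡n σ (2 * p))))
                   (∸-monoˡ-≤ σ (≤-trans (+-monoʳ-≤ σ (m≤m+n (2 * p) _)) (≤-trans (<⇒≤ Z<N) (m∸n≤m n q))))

  2k′≤N : 2 * k′ ≤ N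
  2k′≤N = ≤-trans (m≤m+n (2 * k′) _) (≤-trans inner≤Z (<⇒≤ Z<N))

  gap : W₀ < N
  gap = <-≤-trans (s≤s (≤-trans (m≤m+n W₀ k) (≤-trans (m≤n+m _ (2 * k′)) inner≤Z))) Z<N

  k≤N : k ≤ N
  k≤N = ≤-trans (m≤n+m k W₀) (≤-trans (m≤n+m _ (2 * k′)) (≤-trans inner≤Z (<⇒≤ Z<N)))

  ¬σ<a : ¬ (σ < a)
  ¬σ<a σ<a = <⇒≱ ∣A∣<s (≤-trans (≤-reflexive (sym (m+[n∸m]≡n 1≤s))) σ<a)

  module Tight (a≡σ : a ≡ σ) where

    H⊆hitting : ∀ e → H e ≡ true → hitting (suc q) A e ≡ true
    H⊆hitting e He rewrite uniform e He | ≡ᵇ-refl (2 + p) = edges-meet-A a≡σ 1≤s e He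

    starSum-hittingA : starSum k q (hitting (suc q) A) ≡ hittingValue n q k σ
    starSum-hittingA = trans (starSum-hitting q A k (subst (λ x → q + x ≤ n) (sym a≡σ) q+σ≤n))
                             (cong (hittingValue n q k) a≡σ)

    starSum≤ : starSum k q H ≤ hittingValue n q k σ
    starSum≤ = ≤-trans (starSum-mono H⊆hitting k q) (≤-reflexive starSum-hittingA)

    H≡hittingA : starSum k q H ≡ hittingValue n q k σ → ∀ e → H e ≡ hitting (suc q) A e
    H≡hittingA eq e with H e in He | hitting (suc q) A e in Ge
    ... | true  | true  = refl
    ... | false | false = refl
    ... | true  | false = contradiction (trans (sym (H⊆hitting e He)) Ge) (λ ())
    ... | false | true  = contradiction (trans eq (sym starSum-hittingA)) (<⇒≢ missing-edge)
      where
      kernel = ∃-kernel-meeting p (≡ᵇ-true⇒≡ (∧-conicalˡ _ _ Ge)) (∧-conicalʳ _ _ Ge)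
      T = proj₁ kernel
      ∣T∣≡q = proj₁ (proj₂ kernel)
      T⊆e = proj₁ (proj₂ (proj₂ kernel))
      T⊈∁A = proj₂ (proj₂ (proj₂ kernel))
      missing-edge : starSum k q H < starSum k q (hitting (suc q) A)
      missing-edge = starSum-mono-< H⊆hitting k q Ge He T⊆e ∣T∣≡q (s≤s z≤n)
        (subst (k ≤_) (sym (degree-hitting-meeting q A T⊈∁A ∣T∣≡q)) k≤N)

  module Loose (a<σ : a < σ) where

    open UpperBound q H uniform A using (#edgesAvoiding) renaming (starSum≤ to starSum≤upper)

    Bk = N C k
    t = n C q
    α = (n ∸ a) C q
    β = (n ∸ σ) C q
    X = (n ∸ σ) C p
    Ca = a C k
    Cs = σ C k
    W = (n C k′) * (suc q * #edgesAvoiding)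

    σ≤n : σ ≤ n
    σ≤n = ≤-trans (m≤n+m σ q) q+σ≤n

    σ≤N : σ ≤ N
    σ≤N = ≤-trans (≤-reflexive (sym (m+n∸m≡n q σ))) (∸-monoˡ-≤ q q+σ≤n)

    β+X≤α : β + X ≤ α
    β+X≤α = ≤-trans (≤-reflexive (trans (+-comm β X) (sym (C-pascal (n ∸ σ) p)))) (C-monoˡ-≤ q (∸-monoʳ-< a<σ σ≤n))

    B≤2^σ*X : B ≤ 2 ^ σ * X
    B≤2^σ*X = begin
      (n ∸ 2) C p            ≤⟨ C-monoˡ-≤ p (m∸n≤m n 2) ⟩
      n C p                  ≡⟨ cong (_C p) (m+[n∸m]≡n σ≤n) ⟨
      (σ + (n ∸ σ)) C p      ≤⟨ [c+m]Cj≤2^c*mCj σ (n ∸ σ) p (≤-trans 2p≤n∸σ (n≤1+n _)) ⟩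
      2 ^ σ * X              ∎
      where open ≤-Reasoning

    nCk′≤2^q*NCk′ : n C k′ ≤ 2 ^ q * (N C k′)
    nCk′≤2^q*NCk′ = begin
      n C k′                 ≡⟨ cong (_C k′) (m+[n∸m]≡n (≤-trans (m≤m+n q σ) q+σ≤n)) ⟨
      (q + N) C k′           ≤⟨ [c+m]Cj≤2^c*mCj q N k′ (≤-trans 2k′≤N (n≤1+n N)) ⟩
      2 ^ q * (N C k′)       ∎
      where open ≤-Reasoning

    W≤ : W ≤ K * (N C k′) * X
    W≤ = begin
      (n C k′) * (suc q * #edgesAvoiding)
        ≤⟨ *-mono-≤ nCk′≤2^q*NCk′
             (*-monoʳ-≤ (suc q) (≤-trans edges-avoiding-A≤ (*-monoʳ-≤ ((2 + p) * σ) (*-monoʳ-≤ c B≤2^σ*X)))) ⟩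
      2 ^ q * (N C k′) * (suc q * ((2 + p) * σ * (c * (2 ^ σ * X))))
        ≡⟨ rearrange (2 ^ q) (N C k′) (suc q) ((2 + p) * σ) c (2 ^ σ) X ⟩
      K * (N C k′) * X
        ∎
      where
      open ≤-Reasoning
      rearrange : ∀ a b c d e f g → a * b * (c * (d * (e * (f * g)))) ≡ a * (c * (d * e)) * f * b * g
      rearrange = solve-∀

    gain : Ca * X + W < Bk * X
    gain = begin-strict
      Ca * X + W                       ≤⟨ +-mono-≤ (*-monoˡ-≤ X (C-monoˡ-≤ k (<⇒≤ a<σ))) W≤ ⟩
      Cs * X + K * (N C k′) * X        ≡⟨ +-comm (Cs * X) _ ⟩
      K * (N C k′) * X + Cs * X        ≡⟨ *-distribʳ-+ X (K * (N C k′)) Cs ⟨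
      (K * (N C k′) + Cs) * X          <⟨ *-monoˡ-< X {{>-nonZero (C>0 p≤n∸σ)}} (C-gap N k′ K Cs 2k′≤N gap) ⟩
      Bk * X                           ∎
      where
      open ≤-Reasoning
      p≤n∸σ = ≤-trans (m≤m+n p (p + 0)) 2p≤n∸σ

    strict : starSum k q H < hittingValue n q k σ
    strict = ≤-<-trans (starSum≤upper k′ (≤-trans (+-monoʳ-≤ q (<⇒≤ a<σ)) q+σ≤n))
      (exchange-< Bk t α β X (α ∸ (β + X)) Ca Cs W (sym (m+[n∸m]≡n β+X≤α)) (C-monoˡ-≤ q (m∸n≤m n a))
                  (C-monoˡ-≤ k (<⇒≤ a<σ)) (C-monoˡ-≤ k (≤-trans (<⇒≤ a<σ) σ≤N)) gain)

  starSum≤hittingValue : starSum k q H ≤ hittingValue n q k σ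
  starSum≤hittingValue with <-cmp a σ
  ... | tri< a<σ _ _ = <⇒≤ (Loose.strict a<σ)
  ... | tri≈ _ a≡σ _ = Tight.starSum≤ a≡σ
  ... | tri> _ _ σ<a = contradiction σ<a ¬σ<a

  starSum≡hittingValue⇒ : starSum k q H ≡ hittingValue n q k σ →
    ∃[ S ] (∣ S ∣ ≡ σ × (∀ e → H e ≡ hitting (suc q) S e))
  starSum≡hittingValue⇒ eq with <-cmp a σ
  ... | tri< a<σ _ _ = contradiction eq (<⇒≢ (Loose.strict a<σ))
  ... | tri≈ _ a≡σ _ = A , a≡σ , Tight.H≡hittingA a≡σ eq
  ... | tri> _ _ σ<a = contradiction σ<a ¬σ<a

-- For k = 1 a sunflower is a single edge, which starSum counts once for each of its q-subsets.
sunflowers-vs-starSum : ∀ k′ q → ∃[ c ] (NonZero c × (∀ {n} (G : Hypergraph n) → Uniform (suc q) G →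
  c * numSunflowers (suc k′) (suc q) G ≡ starSum (suc k′) q G))
sunflowers-vs-starSum zero    q = suc q , _ , λ G uniform →
  trans (cong (suc q *_) (numSunflowers-1 G (suc q))) (sym (starSum-1 q G uniform))
sunflowers-vs-starSum (suc j) q = 1 , _ , λ G uniform → trans (*-identityˡ _) (numSunflowers≡starSum G j q uniform)

∣initialSeg∣ : ∀ {n} m → m ≤ n → ∣ tabulate {n = n} (λ i → toℕ i <ᵇ m) ∣ ≡ m
∣initialSeg∣ {zero}  zero    _         = refl
∣initialSeg∣ {suc n} zero    _         = trans (cong ∣_∣ (tabulate-const n)) (∣⊥∣≡0 n)
  where
  tabulate-const : ∀ n → tabulate {n = n} (λ _ → false) ≡ ⊥
  tabulate-const zero    = refl
  tabulate-const (suc n) = cong (outside ∷_) (tabulate-const n)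
∣initialSeg∣ {suc n} (suc m) (s≤s m≤n) = cong suc (∣initialSeg∣ m m≤n)

hitting⇔ : ∀ {n} r (S e : Subset n) → hitting r S e ≡ true ⇔ (∣ e ∣ ≡ r × Nonempty (e ∩ S))
hitting⇔ r S e = mk⇔
  (λ hit → ≡ᵇ-true⇒≡ (∧-conicalˡ _ _ hit) , meets⇒Nonempty e S (∧-conicalʳ _ _ hit))
  (λ (∣e∣≡r , e∩S≢∅) → cong₂ _∧_ (trans (cong (_≡ᵇ r) ∣e∣≡r) (≡ᵇ-refl r)) (Nonempty⇒meets e S e∩S≢∅))

⇔⇒≡ : ∀ {a b : Bool} → (a ≡ true ⇔ b ≡ true) → a ≡ b
⇔⇒≡ {true}  {true}  _   = refl
⇔⇒≡ {false} {false} _   = refl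
⇔⇒≡ {true}  {false} a⇔b = sym (Equivalence.to a⇔b refl)
⇔⇒≡ {false} {true}  a⇔b = Equivalence.from a⇔b refl

starSum-cong : ∀ {n} k q {H G : Hypergraph n} → (∀ e → H e ≡ G e) → starSum k q H ≡ starSum k q G
starSum-cong {n} k q H≗G = ∑-cong (allSubsets n) (λ T → cong (λ d → ⟦ ∣ T ∣ ≡ᵇ q ⟧ * (d C k))
  (∑-cong (allSubsets n) (λ e → cong (λ b → ⟦ b ⟧ * 𝟙 (T ⊆? e)) (H≗G e))))

module Sunflowers {n : ℕ} (p k′ s : ℕ) (1≤s : 1 ≤ s) (large : threshold p k′ s < n) where

  q = suc p
  k = suc k′
  r = 2 + p
  σ = s ∸ 1

  c = proj₁ (sunflowers-vs-starSum k′ q)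

  instance
    c≢0 : NonZero c
    c≢0 = proj₁ (proj₂ (sunflowers-vs-starSum k′ q))

  scaled : ∀ (G : Hypergraph n) → Uniform r G → c * numSunflowers k r G ≡ starSum k q G
  scaled = proj₂ (proj₂ (sunflowers-vs-starSum k′ q))

  q+σ≤n : q + σ ≤ n
  q+σ≤n = ≤-trans (q+σ≤threshold p k′ s) (<⇒≤ large)

  hitting-value : ∀ {S} → ∣ S ∣ ≡ σ → c * numSunflowers k r (hitting r S) ≡ hittingValue n q k σ
  hitting-value {S} ∣S∣≡σ = trans (scaled (hitting r S) (hitting-uniform r S))
    (trans (starSum-hitting q S k (subst (λ x → q + x ≤ n) (sym ∣S∣≡σ) q+σ≤n)) (cong (hittingValue n q k) ∣S∣≡σ))

  -- `extremal n r s` is definitionally `hitting r (initialSeg n s)`.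
  extremal-value : c * numSunflowers k r (extremal n r s) ≡ hittingValue n q k σ
  extremal-value = hitting-value (∣initialSeg∣ σ (≤-trans (m≤n+m σ q) q+σ≤n))

  IsHittingGraph : Hypergraph n → Set
  IsHittingGraph H = ∃[ S ] ((∣ S ∣ ≡ s ∸ 1) × ((e : Subset n) → ((H e ≡ true) ⇔ ((∣ e ∣ ≡ r) × Nonempty (e ∩ S)))))

  module _ (H : Hypergraph n) (uniform : Uniform r H) (ν<s : MatchingNumberLt H s) where

    open Stability p k′ H uniform s ν<s 1≤s large using (starSum≤hittingValue; starSum≡hittingValue⇒)

    sunflowers≤ : numSunflowers k r H ≤ numSunflowers k r (extremal n r s)
    sunflowers≤ = *-cancelˡ-≤ c (≤-trans (≤-reflexive (scaled H uniform))
                                  (≤-trans starSum≤hittingValue (≤-reflexive (sym extremal-value))))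

    sunflowers≡⇔ : (numSunflowers k r H ≡ numSunflowers k r (extremal n r s)) ⇔ IsHittingGraph H
    sunflowers≡⇔ = mk⇔ to from
      where
      to : numSunflowers k r H ≡ numSunflowers k r (extremal n r s) → IsHittingGraph H
      to eq with starSum≡hittingValue⇒ (trans (sym (scaled H uniform)) (trans (cong (c *_) eq) extremal-value))
      ... | S , ∣S∣≡σ , H≗hitting = S , ∣S∣≡σ , λ e → subst (λ b → b ≡ true ⇔ _) (sym (H≗hitting e)) (hitting⇔ r S e)
      from : IsHittingGraph H → numSunflowers k r H ≡ numSunflowers k r (extremal n r s)
      from (S , ∣S∣≡σ , H⇔) = *-cancelˡ-≡ _ _ c (begin
        c * numSunflowers k r H               ≡⟨ scaled H uniform ⟩
        starSum k q H                         ≡⟨ starSum-cong k q H≗hitting ⟩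
        starSum k q (hitting r S)             ≡⟨ scaled (hitting r S) (hitting-uniform r S) ⟨
        c * numSunflowers k r (hitting r S)   ≡⟨ hitting-value ∣S∣≡σ ⟩
        hittingValue n q k σ                  ≡⟨ extremal-value ⟨
        c * numSunflowers k r (extremal n r s) ∎)
        where
        open ≡-Reasoning
        H≗hitting : ∀ e → H e ≡ hitting r S e
        H≗hitting e = ⇔⇒≡ (mk⇔ (Equivalence.from (hitting⇔ r S e) ∘ Equivalence.to (H⇔ e))
                               (Equivalence.from (H⇔ e) ∘ Equivalence.to (hitting⇔ r S e)))

theorem1p4 : (k s r : ℕ) → 1 ≤ k → 1 ≤ s → 2 ≤ r →
    ∃[ n₀ ] ((n : ℕ) → n₀ < n → (H : Hypergraph n) → Uniform r H →
      MatchingNumberLt H s →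
        (numSunflowers k r H ≤ numSunflowers k r (extremal n r s))
        × ((numSunflowers k r H ≡ numSunflowers k r (extremal n r s))
           ⇔ (∃[ S ] ((∣ S ∣ ≡ s ∸ 1)
              × ((e : Subset n) → ((H e ≡ true) ⇔ ((∣ e ∣ ≡ r) × Nonempty (e ∩ S))))))))
theorem1p4 (suc k′) s (suc zero)    _ _   (s≤s ())
theorem1p4 (suc k′) s (suc (suc p)) _ 1≤s _ =
  threshold p k′ s , λ n large H uniform ν<s → let open Sunflowers p k′ s 1≤s large in
    sunflowers≤ H uniform ν<s , sunflowers≡⇔ H uniform ν<s
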